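{- Let $D$ be an integer that is not a perfect square, let $K=\mathbf{Q}(\sqrt D)$ with ring of integers $O_K$, and let $h(x)=h_0+h_1x+\cdots+h_8x^8\in O_K[x]$ with $h_0\neq 0$. For each integer $k\ge 1$ let $M_k$ be the $8\times 8$ matrix over $O_K$ whose entries are all zero except: for $i=2,\dots,8$ the entry in row $i$, column $i-1$ equals $2kh_0$; and for $i=1,\dots,8$ the entry in row $i$, column $8$ equals $(9-i-2k)h_{9-i}$ (so the last column is $((8-2k)h_8,(7-2k)h_7,\dots,(1-2k)h_1)^T$). Let $V_0=[0,0,0,0,0,0,0,1]\in O_K^8$ (a row vector). For an odd prime $p$ define the row vector $U_p\in (O_K/pO_K)^3$ by $(U_p)_j = h^{(p-1)/2}_{p-j}\bmod p$ for $j\in\{1,2,3\}$, where $h^{(p-1)/2}_{m}$ denotes the coefficient of $x^{m}$ in $h(x)^{(p-1)/2}$. Let $p$ be an odd prime with $(h_0,p)=1$ (i.e. $h_0$ is invertible modulo $pO_K$). Then $U_p$ equals the vector consisting of the last three entries, in reversed order, of the row vector \[ \frac{ -1}{h_0^{(p-1)/2}}\, V_0 M_1 M_2\cdots M_{p-1} \pmod{p}. \] That is, if $w=(w_1,\dots,w_8)$ denotes this vector, then $U_p=(w_8,w_7,w_6)$.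
   Context: $O_K/pO_K$ need not be a field (e.g. if $p$ splits in $K$). Vectors are row vectors and multiply matrices on the left. -}

module Defs where

open import Data.Nat as ℕ using (ℕ; zero; suc; _∸_)
open import Data.Integer as ℤ using (ℤ; +_)
open import Data.Rational as ℚ using (ℚ; 0ℚ; 1ℚ)
open import Data.Fin using (Fin; zero; suc; toℕ)
open import Data.List using (List; []; _∷_; tabulate)
open import Data.Product using (Σ; _×_; _,_)
open import Data.Bool using (if_then_else_)
open import Relation.Nullary using (does)
open import Relation.Binary.PropositionalEquality using (_≡_)
open import Function using (_∘_)

-- The quadratic field K = Q(√D): an element a + b√D is the pair (a , b).
-- All operations take the integer D explicitly.

record QF : Set where
  constructor _+_√
  field
    re : ℚ
    im : ℚ
open QF public

0K : QF
0K = 0ℚ + 0ℚ √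

1K : QF
1K = 1ℚ + 0ℚ √

ι : ℤ → QF
ι z = (z ℚ./ 1) + 0ℚ √

addK : QF → QF → QF
addK x y = (re x ℚ.+ re y) + (im x ℚ.+ im y) √

negK : QF → QF
negK x = (ℚ.- re x) + (ℚ.- im x) √

subK : QF → QF → QF
subK x y = addK x (negK y)

-- (a + b√D)(c + d√D) = (ac + D bd) + (ad + bc)√D
mulK : ℤ → QF → QF → QF
mulK D x y = (re x ℚ.* re y ℚ.+ (D ℚ./ 1) ℚ.* (im x ℚ.* im y))
           + (re x ℚ.* im y ℚ.+ im x ℚ.* re y) √

powK : ℤ → QF → ℕ → QF
powK D x zero    = 1K
powK D x (suc n) = mulK D (powK D x n) x

-- An element x = a + b√D of K is an algebraic
-- integer iff its trace 2a and norm a² - D b² are rational integers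
-- (its characteristic polynomial X² - 2a X + (a² - D b²) is then monic
-- with integer coefficients).

IsIntℚ : ℚ → Set
IsIntℚ q = Σ ℤ (λ z → z ℚ./ 1 ≡ q)

InOK : ℤ → QF → Set
InOK D x = IsIntℚ (re x ℚ.+ re x)
         × IsIntℚ (re x ℚ.* re x ℚ.- (D ℚ./ 1) ℚ.* (im x ℚ.* im x))

CongMod : ℤ → ℕ → QF → QF → Set
CongMod D p x y = Σ QF (λ z → InOK D z × subK x y ≡ mulK D (ι (+ p)) z)

-- Polynomials over K as coefficient lists (constant term first).

Poly : Set
Poly = List QF

polyAdd : Poly → Poly → Poly
polyAdd []       q        = q
polyAdd (a ∷ p)  []       = a ∷ p
polyAdd (a ∷ p)  (b ∷ q)  = addK a b ∷ polyAdd p q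

polyScale : ℤ → QF → Poly → Poly
polyScale D c []      = []
polyScale D c (a ∷ p) = mulK D c a ∷ polyScale D c p

polyMul : ℤ → Poly → Poly → Poly
polyMul D []      q = []
polyMul D (a ∷ p) q = polyAdd (polyScale D a q) (0K ∷ polyMul D p q)

polyPow : ℤ → Poly → ℕ → Poly
polyPow D f zero    = 1K ∷ []
polyPow D f (suc n) = polyMul D (polyPow D f n) f

coeff : Poly → ℕ → QF
coeff []      m       = 0K
coeff (a ∷ p) zero    = a
coeff (a ∷ p) (suc m) = coeff p m

coefN : ∀ {n} → (Fin n → QF) → ℕ → QF
coefN {zero}  h m       = 0K
coefN {suc n} h zero    = h zero
coefN {suc n} h (suc m) = coefN (h ∘ suc) m

polyOf : (Fin 9 → QF) → Poly
polyOf h = tabulate h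

Vec8 : Set
Vec8 = Fin 8 → QF

Mat8 : Set
Mat8 = Fin 8 → Fin 8 → QF

sumFin : ∀ {n} → (Fin n → QF) → QF
sumFin {zero}  f = 0K
sumFin {suc n} f = addK (f zero) (sumFin (f ∘ suc))

matMul : ℤ → Mat8 → Mat8 → Mat8
matMul D A B i j = sumFin (λ l → mulK D (A i l) (B l j))

vecMat : ℤ → Vec8 → Mat8 → Vec8
vecMat D v A j = sumFin (λ l → mulK D (v l) (A l j))

idMat : Mat8
idMat i j = if does (toℕ i ℕ.≟ toℕ j) then 1K else 0K

-- M_k (1-based row i = toℕ i + 1, column j = toℕ j + 1):
--   column 8 :            (9 - i - 2k) h_{9-i}
--   row i, column i-1 :    2k h_0        (i = 2..8)
--   otherwise :            0
M : ℤ → (Fin 9 → QF) → ℕ → Mat8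
M D h k i j =
  if does (toℕ j ℕ.≟ 7)
  then mulK D (ι ((+ (9 ∸ suc (toℕ i))) ℤ.- (+ (2 ℕ.* k)))) (coefN h (9 ∸ suc (toℕ i)))
  else (if does (toℕ i ℕ.≟ suc (toℕ j))
        then mulK D (ι (+ (2 ℕ.* k))) (h zero)
        else 0K)

prodM : ℤ → (Fin 9 → QF) → ℕ → Mat8
prodM D h zero    = idMat
prodM D h (suc m) = matMul D (prodM D h m) (M D h (suc m))

V0 : Vec8
V0 j = if does (toℕ j ℕ.≟ 7) then 1K else 0K

Up : ℤ → (Fin 9 → QF) → ℕ → ℕ → QF
Up D h p j = coeff (polyPow D (polyOf h) ((p ∸ 1) ℕ./ 2)) (p ∸ j)

-- w = -(u^{(p-1)/2}) · V_0 M_1 ⋯ M_{p-1}, where u is an inverse of h_0 mod p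
wVec : ℤ → (Fin 9 → QF) → ℕ → QF → Vec8
wVec D h p u j =
  mulK D (negK (powK D u ((p ∸ 1) ℕ./ 2))) (vecMat D V0 (prodM D h (p ∸ 1)) j)

module Submission where

-- With p = 2n + 1 and f = hⁿ, comparing coefficients of x^(z − 1) in h · (hⁿ)′ = n · h′ · hⁿ gives
-- 2z h₀ f_z ≡ Σ_{i ≥ 1} (i − 2z) hᵢ f_{z − i} (mod p), which is the recursion carried out by the
-- last column of M_z, while the subdiagonal of M_k just shifts the row vector.  So by induction
-- V₀ M₁ ⋯ M_k ≡ uⁿ · (2 · 4 ⋯ 2k) · h₀ᵏ · (f_{k−7}, …, f_k) modulo p O_K.  At k = p − 1 = 2n the
-- product 2 · 4 ⋯ 2n is ≡ (p − 1)! ≡ −1 by Wilson's theorem, and u h₀ ≡ 1, so multiplying by −uⁿ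
-- leaves (f_{p−8}, …, f_{p−1}).  That O_K is closed under + and · (needed to multiply
-- congruences) follows from the rational root theorem applied to traces and norms.

open import Defs
open import Data.Nat using (ℕ)
open import Data.Nat.Divisibility using (_∣_)
open import Data.Nat.Primality using (Prime)
open import Data.Integer using (ℤ)
open import Data.Fin using (Fin; zero; #_)
open import Data.Product using (_×_)
open import Relation.Nullary using (¬_)
open import Relation.Binary.PropositionalEquality using (_≡_; _≢_)

open import Level using (Level)
open import Function using (_∘_; _$_)
open import Data.Bool using (true; false; if_then_else_)
open import Data.Unit using (⊤; tt)
open import Data.Maybe using (Maybe; just; nothing)
open import Data.Product using (_,_; proj₁; proj₂)
open import Data.Sum using (_⊎_; inj₁; inj₂)
open import Data.Nat as ℕ using (zero; suc; _≤_; _<_; z≤n; s≤s; _!; NonZero)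
import Data.Nat.Properties as ℕP
import Data.Nat.Solver
open import Data.Nat.Divisibility using (divides; ∣-refl; m%n≡0⇒n∣m)
open import Data.Nat.DivMod using (_/_; _%_; m≡m%n+[m/n]*n; m%n<n; m*n/n≡m)
open import Data.Nat.GCD using (module GCD; module Bézout)
open import Data.Nat.Coprimality using (Coprime; coprime-divisor; recompute; coprime⇒GCD≡1; prime⇒coprime)
import Data.Nat.Coprimality as Coprimality
open import Data.Nat.Primality using (euclidsLemma; prime⇒nonZero; prime⇒nonTrivial)
open import Data.Nat.ListAction using (product)
open import Data.Integer as ℤ using (+_; -[1+_])
import Data.Integer.Properties as ℤP
open import Data.Integer.DivMod using (a≡a%ℕn+[a/ℕn]*n; n%ℕd<d)
open import Data.Integer.Solver using (module +-*-Solver)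
open import Data.Rational as ℚ using (ℚ; mkℚ; 0ℚ; 1ℚ)
import Data.Rational.Properties as ℚP
open import Data.Rational.Solver renaming (module +-*-Solver to ℚ-Solver)
import Data.Rational.Unnormalised as ℚᵘ
import Data.Rational.Unnormalised.Properties as ℚᵘP
open import Data.Fin using (suc; toℕ; inject₁; fromℕ; opposite)
open import Data.Fin.Properties using (toℕ-inject₁; toℕ-inject₁-≢; toℕ<n; opposite-prop)
open import Data.Fin.Relation.Unary.Top using (view; ‵fromℕ; ‵inject₁)
open import Data.List using (List; []; _∷_; tabulate; filter; length; applyDownFrom)
import Data.List.Properties as ListP
open import Data.List.Membership.Propositional using (_∈_)
open import Data.List.Membership.Propositional.Properties using (∈-filter⁺; ∈-filter⁻; ∈-applyDownFrom⁺; ∈-applyDownFrom⁻)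
open import Data.List.Relation.Unary.Any using (here; there)
open import Data.List.Relation.Unary.All using (All; _∷_; lookup)
open import Data.List.Relation.Unary.Unique.Propositional using (Unique; _∷_)
import Data.List.Relation.Unary.Unique.Propositional.Properties as UniqueP
open import Relation.Nullary using (does; contradiction; yes; no; ¬?)
open import Relation.Nullary.Decidable using (dec-false)
open import Relation.Binary.PropositionalEquality
open import Algebra.Bundles using (CommutativeRing)
open import Algebra.Structures using (IsCommutativeRing)
import Algebra.Properties.Ring as RingProperties
import Algebra.Properties.AbelianGroup as AbelianGroupProperties
import Algebra.Properties.CommutativeSemigroup as CommutativeSemigroupProperties
import Algebra.Solver.Ring
open import Algebra.Solver.Ring.AlmostCommutativeRing using (fromCommutativeRing; _-Raw-AlmostCommutative⟶_)
import Relation.Binary.Reasoning.Setoid as SetoidReasoning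
open import Relation.Binary.Bundles using (Setoid)

fromℤ : ℤ → ℚ
fromℤ z = z ℚ./ 1

private
  toℚᵘ-fromℤ : ∀ z → ℚ.toℚᵘ (fromℤ z) ℚᵘ.≃ ℚᵘ.mkℚᵘ z 0
  toℚᵘ-fromℤ z = ℚP.toℚᵘ-fromℚᵘ (ℚᵘ.mkℚᵘ z 0)

  fromℤ-unique : ∀ {x} z → ℚ.toℚᵘ x ℚᵘ.≃ ℚᵘ.mkℚᵘ z 0 → x ≡ fromℤ z
  fromℤ-unique z x≃z = ℚP.toℚᵘ-injective (ℚᵘP.≃-trans x≃z (ℚᵘP.≃-sym (toℚᵘ-fromℤ z)))

fromℤ-+ : ∀ a b → fromℤ (a ℤ.+ b) ≡ fromℤ a ℚ.+ fromℤ b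
fromℤ-+ a b = sym (fromℤ-unique (a ℤ.+ b) (ℚᵘP.≃-trans (ℚP.toℚᵘ-homo-+ (fromℤ a) (fromℤ b))
  (ℚᵘP.≃-trans (ℚᵘP.+-cong (toℚᵘ-fromℤ a) (toℚᵘ-fromℤ b)) (ℚᵘ.*≡* (solve 2 (λ a b →
    (a :* con (+ 1) :+ b :* con (+ 1)) :* con (+ 1) := (a :+ b) :* (con (+ 1) :* con (+ 1))) refl a b)))))
  where open +-*-Solver

fromℤ-* : ∀ a b → fromℤ (a ℤ.* b) ≡ fromℤ a ℚ.* fromℤ b
fromℤ-* a b = sym (fromℤ-unique (a ℤ.* b) (ℚᵘP.≃-trans (ℚP.toℚᵘ-homo-* (fromℤ a) (fromℤ b))
  (ℚᵘP.*-cong (toℚᵘ-fromℤ a) (toℚᵘ-fromℤ b))))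

fromℤ-neg : ∀ a → fromℤ (ℤ.- a) ≡ ℚ.- fromℤ a
fromℤ-neg a = sym (fromℤ-unique (ℤ.- a) (ℚᵘP.≃-trans (ℚP.toℚᵘ-homo‿- (fromℤ a)) (ℚᵘP.-‿cong (toℚᵘ-fromℤ a))))

fromℤ-injective : ∀ {a b} → fromℤ a ≡ fromℤ b → a ≡ b
fromℤ-injective {a} {b} eq with ℚᵘP.≃-trans (ℚᵘP.≃-sym (toℚᵘ-fromℤ a)) (ℚᵘP.≃-trans (ℚP.toℚᵘ-cong eq) (toℚᵘ-fromℤ b))
... | ℚᵘ.*≡* a*1≡b*1 = trans (sym (ℤP.*-identityʳ a)) (trans a*1≡b*1 (ℤP.*-identityʳ b))

isInt-fromℤ : ∀ z → IsIntℚ (fromℤ z)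
isInt-fromℤ z = z , refl

isInt-+ : ∀ {x y} → IsIntℚ x → IsIntℚ y → IsIntℚ (x ℚ.+ y)
isInt-+ (a , refl) (b , refl) = a ℤ.+ b , fromℤ-+ a b

isInt-* : ∀ {x y} → IsIntℚ x → IsIntℚ y → IsIntℚ (x ℚ.* y)
isInt-* (a , refl) (b , refl) = a ℤ.* b , fromℤ-* a b

isInt-neg : ∀ {x} → IsIntℚ x → IsIntℚ (ℚ.- x)
isInt-neg (a , refl) = ℤ.- a , fromℤ-neg a

isInt-sub : ∀ {x y} → IsIntℚ x → IsIntℚ y → IsIntℚ (x ℚ.- y)
isInt-sub x∈ℤ y∈ℤ = isInt-+ x∈ℤ (isInt-neg y∈ℤ)

-- Rational root theorem for monic quadratics: clearing the denominator d of t = n / d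
-- gives n² = d (s n - q d), and d is coprime to n.
isInt-root : ∀ {s q} t → IsIntℚ s → IsIntℚ q → t ℚ.* t ℚ.+ q ≡ s ℚ.* t → IsIntℚ t
isInt-root t@(mkℚ n d-1 n⊥d) (s , refl) (q , refl) root = n , n/1≡t
  where
  d : ℕ
  d = suc d-1
  t*d≡n : t ℚ.* fromℤ (+ d) ≡ fromℤ n
  t*d≡n = fromℤ-unique n (ℚᵘP.≃-trans (ℚP.toℚᵘ-homo-* t (fromℤ (+ d)))
    (ℚᵘP.≃-trans (ℚᵘP.*-cong (ℚᵘP.≃-refl {ℚᵘ.mkℚᵘ n d-1}) (toℚᵘ-fromℤ (+ d))) (ℚᵘ.*≡* (ℤP.*-assoc n (+ d) (+ 1)))))
  n²≡d*r : fromℤ (n ℤ.* n) ≡ fromℤ ((s ℤ.* n ℤ.- q ℤ.* + d) ℤ.* + d)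
  n²≡d*r = begin
    fromℤ (n ℤ.* n)                                   ≡⟨ fromℤ-* n n ⟩
    fromℤ n ℚ.* fromℤ n                               ≡⟨ cong₂ ℚ._*_ t*d≡n t*d≡n ⟨
    t ℚ.* D ℚ.* (t ℚ.* D)                             ≡⟨ solve 4 (λ T D S Q → T :* D :* (T :* D)
                                                           := (T :* T :+ Q) :* D :* D :- Q :* D :* D) refl t D S Q ⟩
    (t ℚ.* t ℚ.+ Q) ℚ.* D ℚ.* D ℚ.- Q ℚ.* D ℚ.* D      ≡⟨ cong (λ w → w ℚ.* D ℚ.* D ℚ.- Q ℚ.* D ℚ.* D) root ⟩
    S ℚ.* t ℚ.* D ℚ.* D ℚ.- Q ℚ.* D ℚ.* D              ≡⟨ solve 4 (λ T D S Q → S :* T :* D :* D :- Q :* D :* D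
                                                           := (S :* (T :* D) :+ :- (Q :* D)) :* D) refl t D S Q ⟩
    (S ℚ.* (t ℚ.* D) ℚ.+ ℚ.- (Q ℚ.* D)) ℚ.* D         ≡⟨ cong (λ w → (S ℚ.* w ℚ.+ ℚ.- (Q ℚ.* D)) ℚ.* D) t*d≡n ⟩
    (S ℚ.* fromℤ n ℚ.+ ℚ.- (Q ℚ.* D)) ℚ.* D           ≡⟨ homs ⟨
    fromℤ ((s ℤ.* n ℤ.- q ℤ.* + d) ℤ.* + d)          ∎
    where
    open ≡-Reasoning
    open ℚ-Solver
    S = fromℤ s
    Q = fromℤ q
    D = fromℤ (+ d)
    homs : fromℤ ((s ℤ.* n ℤ.- q ℤ.* + d) ℤ.* + d) ≡ (S ℚ.* fromℤ n ℚ.+ ℚ.- (Q ℚ.* D)) ℚ.* D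
    homs = trans (fromℤ-* (s ℤ.* n ℤ.- q ℤ.* + d) (+ d)) (cong (ℚ._* D) (trans (fromℤ-+ (s ℤ.* n) (ℤ.- (q ℤ.* + d)))
      (cong₂ ℚ._+_ (fromℤ-* s n) (trans (fromℤ-neg (q ℤ.* + d)) (cong ℚ.-_ (fromℤ-* q (+ d)))))))
  d∣n : d ∣ ℤ.∣ n ∣
  d∣n = coprime-divisor (Coprimality.sym (recompute n⊥d)) (divides ℤ.∣ s ℤ.* n ℤ.- q ℤ.* + d ∣ (trans (sym (ℤP.abs-* n n))
    (trans (cong ℤ.∣_∣ (fromℤ-injective {n ℤ.* n} {(s ℤ.* n ℤ.- q ℤ.* + d) ℤ.* + d} n²≡d*r)) (ℤP.abs-* (s ℤ.* n ℤ.- q ℤ.* + d) (+ d)))))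
  n/1≡t : fromℤ n ≡ t
  n/1≡t = d≡1⇒n/1≡t d-1 n⊥d (recompute n⊥d (d∣n , ∣-refl))
    where
    d≡1⇒n/1≡t : ∀ d-1 .(c : Coprime ℤ.∣ n ∣ (suc d-1)) → suc d-1 ≡ 1 → fromℤ n ≡ mkℚ n d-1 c
    d≡1⇒n/1≡t zero c refl = ℚP.↥p/↧p≡p (mkℚ n 0 c)

-- The quadratic field ℚ(√D) and its ring of integers

module _ (D : ℤ) where
  open ℚ-Solver

  private
    g : ℚ
    g = fromℤ D

    √-≡ : ∀ {a b c d} → a ≡ c → b ≡ d → a + b √ ≡ c + d √
    √-≡ = cong₂ _+_√

    +-assoc : ∀ x y z → addK (addK x y) z ≡ addK x (addK y z)
    +-assoc x y z = √-≡ (ℚP.+-assoc (re x) (re y) (re z)) (ℚP.+-assoc (im x) (im y) (im z))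

    +-comm : ∀ x y → addK x y ≡ addK y x
    +-comm x y = √-≡ (ℚP.+-comm (re x) (re y)) (ℚP.+-comm (im x) (im y))

    +-identityˡ : ∀ x → addK 0K x ≡ x
    +-identityˡ x = √-≡ (ℚP.+-identityˡ (re x)) (ℚP.+-identityˡ (im x))

    +-identityʳ : ∀ x → addK x 0K ≡ x
    +-identityʳ x = √-≡ (ℚP.+-identityʳ (re x)) (ℚP.+-identityʳ (im x))

    -‿inverseˡ : ∀ x → addK (negK x) x ≡ 0K
    -‿inverseˡ x = √-≡ (ℚP.+-inverseˡ (re x)) (ℚP.+-inverseˡ (im x))

    -‿inverseʳ : ∀ x → addK x (negK x) ≡ 0K
    -‿inverseʳ x = √-≡ (ℚP.+-inverseʳ (re x)) (ℚP.+-inverseʳ (im x))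

    *-comm : ∀ x y → mulK D x y ≡ mulK D y x
    *-comm (a + b √) (c + d √) =
      √-≡ (solve 5 (λ a b c d g → a :* c :+ g :* (b :* d) := c :* a :+ g :* (d :* b)) refl a b c d g)
          (solve 4 (λ a b c d → a :* d :+ b :* c := c :* b :+ d :* a) refl a b c d)

    *-assoc : ∀ x y z → mulK D (mulK D x y) z ≡ mulK D x (mulK D y z)
    *-assoc (a + b √) (c + d √) (e + f √) =
      √-≡ (solve 7 (λ a b c d e f g → (a :* c :+ g :* (b :* d)) :* e :+ g :* ((a :* d :+ b :* c) :* f)
                                     := a :* (c :* e :+ g :* (d :* f)) :+ g :* (b :* (c :* f :+ d :* e))) refl a b c d e f g)
          (solve 7 (λ a b c d e f g → (a :* c :+ g :* (b :* d)) :* f :+ (a :* d :+ b :* c) :* e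
                                     := a :* (c :* f :+ d :* e) :+ b :* (c :* e :+ g :* (d :* f))) refl a b c d e f g)

    *-identityˡ : ∀ x → mulK D 1K x ≡ x
    *-identityˡ (a + b √) =
      √-≡ (solve 3 (λ a b g → con 1ℚ :* a :+ g :* (con 0ℚ :* b) := a) refl a b g)
          (solve 2 (λ a b → con 1ℚ :* b :+ con 0ℚ :* a := b) refl a b)

    *-identityʳ : ∀ x → mulK D x 1K ≡ x
    *-identityʳ x = trans (*-comm x 1K) (*-identityˡ x)

    *-distribˡ-+ : ∀ x y z → mulK D x (addK y z) ≡ addK (mulK D x y) (mulK D x z)
    *-distribˡ-+ (a + b √) (c + d √) (e + f √) =
      √-≡ (solve 7 (λ a b c d e f g → a :* (c :+ e) :+ g :* (b :* (d :+ f))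
                                     := (a :* c :+ g :* (b :* d)) :+ (a :* e :+ g :* (b :* f))) refl a b c d e f g)
          (solve 6 (λ a b c d e f → a :* (d :+ f) :+ b :* (c :+ e) := (a :* d :+ b :* c) :+ (a :* f :+ b :* e)) refl a b c d e f)

    *-distribʳ-+ : ∀ x y z → mulK D (addK y z) x ≡ addK (mulK D y x) (mulK D z x)
    *-distribʳ-+ x y z = trans (*-comm (addK y z) x)
      (trans (*-distribˡ-+ x y z) (cong₂ addK (*-comm x y) (*-comm x z)))

  isCommutativeRing : IsCommutativeRing _≡_ addK (mulK D) negK 0K 1K
  isCommutativeRing = record
    { isRing = record
      { +-isAbelianGroup = record
        { isGroup = record
          { isMonoid = record
            { isSemigroup = record
              { isMagma = record { isEquivalence = isEquivalence ; ∙-cong = cong₂ addK }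
              ; assoc = +-assoc }
            ; identity = +-identityˡ , +-identityʳ }
          ; inverse = -‿inverseˡ , -‿inverseʳ
          ; ⁻¹-cong = cong negK }
        ; comm = +-comm }
      ; *-cong = cong₂ (mulK D)
      ; *-assoc = *-assoc
      ; *-identity = *-identityˡ , *-identityʳ
      ; distrib = *-distribˡ-+ , *-distribʳ-+ }
    ; *-comm = *-comm }

  quadraticRing : CommutativeRing _ _
  quadraticRing = record { isCommutativeRing = isCommutativeRing }

  ι-+ : ∀ a b → ι (a ℤ.+ b) ≡ addK (ι a) (ι b)
  ι-+ a b = cong₂ _+_√ (fromℤ-+ a b) refl

  ι-* : ∀ a b → ι (a ℤ.* b) ≡ mulK D (ι a) (ι b)
  ι-* a b = cong₂ _+_√ (trans (fromℤ-* a b) (solve 3 (λ a b g → a :* b := a :* b :+ g :* (con 0ℚ :* con 0ℚ)) refl (fromℤ a) (fromℤ b) g))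
                       (solve 2 (λ a b → con 0ℚ := a :* con 0ℚ :+ con 0ℚ :* b) refl (fromℤ a) (fromℤ b))

  ι-neg : ∀ a → ι (ℤ.- a) ≡ negK (ι a)
  ι-neg a = cong₂ _+_√ (fromℤ-neg a) refl

  ι-homomorphism : ℤ.+-*-rawRing -Raw-AlmostCommutative⟶ fromCommutativeRing quadraticRing
  ι-homomorphism = record
    { ⟦_⟧ = ι ; +-homo = ι-+ ; *-homo = ι-* ; -‿homo = ι-neg ; 0-homo = refl ; 1-homo = refl }

  ι-≟ : ∀ i j → Maybe (ι i ≡ ι j)
  ι-≟ i j with i ℤ.≟ j
  ... | yes refl = just refl
  ... | no _     = nothing

module K-Solver (D : ℤ) = Algebra.Solver.Ring ℤ.+-*-rawRing (fromCommutativeRing (quadraticRing D)) (ι-homomorphism D) (ι-≟ D)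

-- InOK D x constrains only re x and im x through non-injective arithmetic, so x cannot be
-- recovered from it by unification; this wrapper can.
record Integral (D : ℤ) (x : QF) : Set where
  constructor integral
  field inOK : InOK D x

module _ (D : ℤ) where
  open ℚ-Solver

  private
    g : ℚ
    g = fromℤ D

  -- With x = a + b√D and y = c + d√D, the traces τ = tr (x y) and σ = tr (x ȳ) satisfy
  -- τ + σ = tr x tr y and τ σ = N y (tr x² − 2 N x) + N x (tr y² − 2 N y), so both are
  -- roots of a monic integral quadratic.
  conjugate-traces-integral : ∀ {a b c d} → InOK D (a + b √) → InOK D (c + d √) →
    IsIntℚ ((a ℚ.* c ℚ.+ g ℚ.* (b ℚ.* d)) ℚ.+ (a ℚ.* c ℚ.+ g ℚ.* (b ℚ.* d))) ×
    IsIntℚ ((a ℚ.* c ℚ.- g ℚ.* (b ℚ.* d)) ℚ.+ (a ℚ.* c ℚ.- g ℚ.* (b ℚ.* d)))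
  conjugate-traces-integral {a} {b} {c} {d} (A∈ℤ , Nx∈ℤ) (C∈ℤ , Ny∈ℤ) =
    isInt-root τ AC∈ℤ Q∈ℤ (root τ σ τσ τ+σ) ,
    isInt-root σ AC∈ℤ Q∈ℤ (root σ τ (trans (ℚP.*-comm σ τ) τσ) (trans (ℚP.+-comm σ τ) τ+σ))
    where
    τ = (a ℚ.* c ℚ.+ g ℚ.* (b ℚ.* d)) ℚ.+ (a ℚ.* c ℚ.+ g ℚ.* (b ℚ.* d))
    σ = (a ℚ.* c ℚ.- g ℚ.* (b ℚ.* d)) ℚ.+ (a ℚ.* c ℚ.- g ℚ.* (b ℚ.* d))
    A = a ℚ.+ a
    C = c ℚ.+ c
    Nx = a ℚ.* a ℚ.- g ℚ.* (b ℚ.* b)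
    Ny = c ℚ.* c ℚ.- g ℚ.* (d ℚ.* d)
    Q = Ny ℚ.* (A ℚ.* A ℚ.- (Nx ℚ.+ Nx)) ℚ.+ Nx ℚ.* (C ℚ.* C ℚ.- (Ny ℚ.+ Ny))
    AC∈ℤ : IsIntℚ (A ℚ.* C)
    AC∈ℤ = isInt-* A∈ℤ C∈ℤ
    Q∈ℤ : IsIntℚ Q
    Q∈ℤ = isInt-+ (isInt-* Ny∈ℤ (isInt-sub (isInt-* A∈ℤ A∈ℤ) (isInt-+ Nx∈ℤ Nx∈ℤ)))
                  (isInt-* Nx∈ℤ (isInt-sub (isInt-* C∈ℤ C∈ℤ) (isInt-+ Ny∈ℤ Ny∈ℤ)))
    τ+σ : τ ℚ.+ σ ≡ A ℚ.* C
    τ+σ = solve 5 (λ a b c d g → ((a :* c :+ g :* (b :* d)) :+ (a :* c :+ g :* (b :* d)))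
                               :+ ((a :* c :- g :* (b :* d)) :+ (a :* c :- g :* (b :* d))) := (a :+ a) :* (c :+ c)) refl a b c d g
    τσ : τ ℚ.* σ ≡ Q
    τσ = solve 5 (λ a b c d g → ((a :* c :+ g :* (b :* d)) :+ (a :* c :+ g :* (b :* d)))
                              :* ((a :* c :- g :* (b :* d)) :+ (a :* c :- g :* (b :* d)))
      := (c :* c :- g :* (d :* d)) :* ((a :+ a) :* (a :+ a) :- ((a :* a :- g :* (b :* b)) :+ (a :* a :- g :* (b :* b))))
       :+ (a :* a :- g :* (b :* b)) :* ((c :+ c) :* (c :+ c) :- ((c :* c :- g :* (d :* d)) :+ (c :* c :- g :* (d :* d))))) refl a b c d g
    root : ∀ t s → t ℚ.* s ≡ Q → t ℚ.+ s ≡ A ℚ.* C → t ℚ.* t ℚ.+ Q ≡ (A ℚ.* C) ℚ.* t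
    root t s ts≡Q t+s≡AC = begin
      t ℚ.* t ℚ.+ Q          ≡⟨ cong (t ℚ.* t ℚ.+_) ts≡Q ⟨
      t ℚ.* t ℚ.+ t ℚ.* s    ≡⟨ solve 2 (λ t s → t :* t :+ t :* s := (t :+ s) :* t) refl t s ⟩
      (t ℚ.+ s) ℚ.* t        ≡⟨ cong (ℚ._* t) t+s≡AC ⟩
      (A ℚ.* C) ℚ.* t        ∎
      where open ≡-Reasoning

  integral-+ : ∀ {x y} → Integral D x → Integral D y → Integral D (addK x y)
  integral-+ {x} {y} (integral x∈O@(A∈ℤ , Nx∈ℤ)) (integral y∈O@(C∈ℤ , Ny∈ℤ)) = integral $
    subst IsIntℚ (solve 2 (λ a c → (a :+ a) :+ (c :+ c) := (a :+ c) :+ (a :+ c)) refl a c) (isInt-+ A∈ℤ C∈ℤ) ,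
    subst IsIntℚ (solve 5 (λ a b c d g → ((a :* a :- g :* (b :* b)) :+ (c :* c :- g :* (d :* d)))
                                         :+ ((a :* c :- g :* (b :* d)) :+ (a :* c :- g :* (b :* d)))
                                       := (a :+ c) :* (a :+ c) :- g :* ((b :+ d) :* (b :+ d))) refl a b c d g)
      (isInt-+ (isInt-+ Nx∈ℤ Ny∈ℤ) (proj₂ (conjugate-traces-integral {a} {b} {c} {d} x∈O y∈O)))
    where
    a = re x
    b = im x
    c = re y
    d = im y

  integral-* : ∀ {x y} → Integral D x → Integral D y → Integral D (mulK D x y)
  integral-* {x} {y} (integral x∈O@(_ , Nx∈ℤ)) (integral y∈O@(_ , Ny∈ℤ)) = integral $
    proj₁ (conjugate-traces-integral {a} {b} {c} {d} x∈O y∈O) ,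
    subst IsIntℚ (solve 5 (λ a b c d g → (a :* a :- g :* (b :* b)) :* (c :* c :- g :* (d :* d))
                         := (a :* c :+ g :* (b :* d)) :* (a :* c :+ g :* (b :* d)) :- g :* ((a :* d :+ b :* c) :* (a :* d :+ b :* c)))
                   refl a b c d g)
      (isInt-* Nx∈ℤ Ny∈ℤ)
    where
    a = re x
    b = im x
    c = re y
    d = im y

  integral-neg : ∀ {x} → Integral D x → Integral D (negK x)
  integral-neg {x} (integral (A∈ℤ , Nx∈ℤ)) = integral $
    subst IsIntℚ (solve 1 (λ a → :- (a :+ a) := :- a :+ :- a) refl a) (isInt-neg A∈ℤ) ,
    subst IsIntℚ (solve 3 (λ a b g → a :* a :- g :* (b :* b) := :- a :* :- a :- g :* (:- b :* :- b)) refl a b g) Nx∈ℤ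
    where
    a = re x
    b = im x

  integral-ι : ∀ z → Integral D (ι z)
  integral-ι z = integral $
    subst IsIntℚ (fromℤ-+ z z) (isInt-fromℤ (z ℤ.+ z)) ,
    subst IsIntℚ (trans (fromℤ-* z z) (solve 2 (λ z g → z :* z := z :* z :- g :* (con 0ℚ :* con 0ℚ)) refl (fromℤ z) g))
      (isInt-fromℤ (z ℤ.* z))

module _ (D : ℤ) where
  open CommutativeRing (quadraticRing D) using (_+_; _*_; 0#; 1#; *-identityˡ; *-identityʳ)
  open K-Solver D using (solve; _:+_; _:*_; _:=_; con)

  powK-* : ∀ x y m → powK D (x * y) m ≡ powK D x m * powK D y m
  powK-* x y zero    = sym (*-identityˡ 1#)
  powK-* x y (suc m) = trans (cong (_* (x * y)) (powK-* x y m))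
    (solve 4 (λ a b x y → (a :* b) :* (x :* y) := (a :* x) :* (b :* y)) refl (powK D x m) (powK D y m) x y)

  powK-+ : ∀ x m n → powK D x (m ℕ.+ n) ≡ powK D x m * powK D x n
  powK-+ x zero    n = sym (*-identityˡ (powK D x n))
  powK-+ x (suc m) n = trans (cong (_* x) (powK-+ x m n))
    (solve 3 (λ a b x → (a :* b) :* x := (a :* x) :* b) refl (powK D x m) (powK D x n) x)

  powK-1# : ∀ m → powK D 1# m ≡ 1#
  powK-1# zero    = refl
  powK-1# (suc m) = trans (*-identityʳ (powK D 1# m)) (powK-1# m)

-- Congruence modulo π S for a subring S

module Congruence {c ℓ : Level} (R : CommutativeRing c ℓ) where

  open CommutativeRing R using (Carrier; _≈_; _+_; _*_; -_; _-_; 0#; 1#; ring; +-abelianGroup;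
    +-commutativeSemigroup; *-commutativeSemigroup; +-cong; +-congˡ; +-congʳ; +-assoc; +-identityʳ;
    -‿cong; -‿inverseˡ; -‿inverseʳ; *-congˡ; *-congʳ; *-assoc; *-identityˡ; *-identityʳ; distribˡ; zeroʳ)
    renaming (sym to ≈-sym)
  open RingProperties ring using (-‿distribʳ-*; x[y-z]≈xy-xz; [y-z]x≈yx-zx; -0#≈0#)
  open AbelianGroupProperties +-abelianGroup using (⁻¹-anti-homo‿-; ⁻¹-∙-comm)
  open CommutativeSemigroupProperties +-commutativeSemigroup using (interchange)
  open CommutativeSemigroupProperties *-commutativeSemigroup using (x∙yz≈y∙xz)
  open SetoidReasoning (CommutativeRing.setoid R)

  module Modulo
    (S : Carrier → Set) (S-0# : S 0#) (S-+ : ∀ {x y} → S x → S y → S (x + y))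
    (S-neg : ∀ {x} → S x → S (- x)) (S-* : ∀ {x y} → S x → S y → S (x * y))
    (π : Carrier) where

    infix 4 _≋_
    record _≋_ (x y : Carrier) : Set (c Level.⊔ ℓ) where
      constructor multiple
      field
        {quotient}     : Carrier
        quotient∈S     : S quotient
        x-y≈π*quotient : x - y ≈ π * quotient

    ≈⇒≋ : ∀ {x y} → x ≈ y → x ≋ y
    ≈⇒≋ {x} {y} x≈y = multiple S-0# (begin
      x - y      ≈⟨ +-congʳ x≈y ⟩
      y - y      ≈⟨ -‿inverseʳ y ⟩
      0#         ≈⟨ zeroʳ π ⟨
      π * 0#     ∎)

    ≋-sym : ∀ {x y} → x ≋ y → y ≋ x
    ≋-sym {x} {y} (multiple {z} z∈S x-y≈πz) = multiple (S-neg z∈S) (begin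
      y - x      ≈⟨ ⁻¹-anti-homo‿- x y ⟨
      - (x - y)  ≈⟨ -‿cong x-y≈πz ⟩
      - (π * z)  ≈⟨ -‿distribʳ-* π z ⟩
      π * - z    ∎)

    ≋-trans : ∀ {x y w} → x ≋ y → y ≋ w → x ≋ w
    ≋-trans {x} {y} {w} (multiple {z} z∈S x-y≈πz) (multiple {z′} z′∈S y-w≈πz′) = multiple (S-+ z∈S z′∈S) (begin
      x - w                   ≈⟨ +-congʳ (+-identityʳ x) ⟨
      (x + 0#) - w            ≈⟨ +-congʳ (+-congˡ (-‿inverseˡ y)) ⟨
      (x + (- y + y)) - w     ≈⟨ +-congʳ (+-assoc x (- y) y) ⟨
      ((x - y) + y) - w       ≈⟨ +-assoc (x - y) y (- w) ⟩
      (x - y) + (y - w)       ≈⟨ +-cong x-y≈πz y-w≈πz′ ⟩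
      π * z + π * z′          ≈⟨ distribˡ π z z′ ⟨
      π * (z + z′)            ∎)

    ≋-setoid : Setoid c (c Level.⊔ ℓ)
    ≋-setoid = record
      { Carrier = Carrier ; _≈_ = _≋_
      ; isEquivalence = record { refl = ≈⇒≋ (CommutativeRing.refl R) ; sym = ≋-sym ; trans = ≋-trans } }

    +-cong≋ : ∀ {x y x′ y′} → x ≋ y → x′ ≋ y′ → x + x′ ≋ y + y′
    +-cong≋ {x} {y} {x′} {y′} (multiple {z} z∈S x-y≈πz) (multiple {z′} z′∈S x′-y′≈πz′) = multiple (S-+ z∈S z′∈S) (begin
      (x + x′) - (y + y′)        ≈⟨ +-congˡ (⁻¹-∙-comm y y′) ⟨
      (x + x′) + (- y + - y′)    ≈⟨ interchange x x′ (- y) (- y′) ⟩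
      (x - y) + (x′ - y′)        ≈⟨ +-cong x-y≈πz x′-y′≈πz′ ⟩
      π * z + π * z′             ≈⟨ distribˡ π z z′ ⟨
      π * (z + z′)               ∎)

    -‿cong≋ : ∀ {x y} → x ≋ y → - x ≋ - y
    -‿cong≋ {x} {y} (multiple {z} z∈S x-y≈πz) = multiple (S-neg z∈S) (begin
      - x - - y        ≈⟨ ⁻¹-∙-comm x (- y) ⟩
      - (x - y)        ≈⟨ -‿cong x-y≈πz ⟩
      - (π * z)        ≈⟨ -‿distribʳ-* π z ⟩
      π * - z          ∎)

    *-congˡ≋ : ∀ {a x y} → S a → x ≋ y → a * x ≋ a * y
    *-congˡ≋ {a} {x} {y} a∈S (multiple {z} z∈S x-y≈πz) = multiple (S-* a∈S z∈S) (begin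
      a * x - a * y    ≈⟨ x[y-z]≈xy-xz a x y ⟨
      a * (x - y)      ≈⟨ *-congˡ x-y≈πz ⟩
      a * (π * z)      ≈⟨ x∙yz≈y∙xz a π z ⟩
      π * (a * z)      ∎)

    *-congʳ≋ : ∀ {a x y} → S a → x ≋ y → x * a ≋ y * a
    *-congʳ≋ {a} {x} {y} a∈S (multiple {z} z∈S x-y≈πz) = multiple (S-* z∈S a∈S) (begin
      x * a - y * a    ≈⟨ [y-z]x≈yx-zx a x y ⟨
      (x - y) * a      ≈⟨ *-congʳ x-y≈πz ⟩
      (π * z) * a      ≈⟨ *-assoc π z a ⟩
      π * (z * a)      ∎)

    *-cong≋ : ∀ {a b x y} → S b → S x → a ≋ b → x ≋ y → a * x ≋ b * y
    *-cong≋ b∈S x∈S a≋b x≋y = ≋-trans (*-congʳ≋ x∈S a≋b) (*-congˡ≋ b∈S x≋y)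

    π*x≋0 : ∀ {x} → S x → π * x ≋ 0#
    π*x≋0 {x} x∈S = multiple x∈S (begin
      π * x - 0#    ≈⟨ +-congˡ -0#≈0# ⟩
      π * x + 0#    ≈⟨ +-identityʳ (π * x) ⟩
      π * x         ∎)

    inverse-unique≋ : ∀ {a x y} → S a → S x → S y → x * a ≋ 1# → a * y ≋ 1# → x ≋ y
    inverse-unique≋ {a} {x} {y} a∈S x∈S y∈S x*a≋1 a*y≋1 = ≋-trans (≈⇒≋ (≈-sym (*-identityʳ x)))
      (≋-trans (*-congˡ≋ x∈S (≋-sym a*y≋1)) (≋-trans (≈⇒≋ (≈-sym (*-assoc x a y)))
        (≋-trans (*-congʳ≋ y∈S x*a≋1) (≈⇒≋ (*-identityˡ y)))))

-- Wilson's theorem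

product-remove : ∀ {b} ys → b ∈ ys → Unique ys → product ys ≡ b ℕ.* product (filter (λ x → ¬? (x ℕ.≟ b)) ys)
product-remove {b} (y ∷ ys) b∈y∷ys (y∉ys ∷ ys!) with y ℕ.≟ b | b∈y∷ys
... | yes refl | _ = cong (y ℕ.*_) (cong product (begin
  ys                   ≡⟨ ListP.filter-all ≢y? (Data.List.Relation.Unary.All.map (λ y≢x x≡y → y≢x (sym x≡y)) y∉ys) ⟨
  filter ≢y? ys        ≡⟨ ListP.filter-reject ≢y? (λ y≢y → y≢y refl) ⟨
  filter ≢y? (y ∷ ys)  ∎))
  where
  open ≡-Reasoning
  ≢y? = λ x → ¬? (x ℕ.≟ y)
... | no y≢b | here b≡y   = contradiction (sym b≡y) y≢b
... | no y≢b | there b∈ys = begin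
  y ℕ.* product ys                                ≡⟨ cong (y ℕ.*_) (product-remove ys b∈ys ys!) ⟩
  y ℕ.* (b ℕ.* product (filter ≢b? ys))           ≡⟨ x∙yz≈y∙xz y b _ ⟩
  b ℕ.* product (y ∷ filter ≢b? ys)               ≡⟨ cong (λ zs → b ℕ.* product zs) (ListP.filter-accept ≢b? y≢b) ⟨
  b ℕ.* product (filter ≢b? (y ∷ ys))             ∎
  where
  open ≡-Reasoning
  open CommutativeSemigroupProperties ℕP.*-commutativeSemigroup using (x∙yz≈y∙xz)
  ≢b? = λ x → ¬? (x ℕ.≟ b)

module IntegersModulo (p : ℕ) where
  open Congruence.Modulo ℤP.+-*-commutativeRing (λ _ → ⊤) tt (λ _ _ → tt) (λ _ → tt) (λ _ _ → tt) (+ p) public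

  multiple<p⇒0 : ∀ {d} z → d < p → + d ≡ + p ℤ.* z → d ≡ 0
  multiple<p⇒0 {d} z d<p d≡pz = p∣d (trans (cong ℤ.∣_∣ d≡pz) (ℤP.abs-* (+ p) z))
    where
    p∣d : ∀ {n} → d ≡ p ℕ.* n → d ≡ 0
    p∣d {zero}  d≡p*0  = trans d≡p*0 (ℕP.*-zeroʳ p)
    p∣d {suc k} d≡p*sk = contradiction (subst (p ≤_) (sym d≡p*sk) (ℕP.m≤m*n p (suc k))) (ℕP.<⇒≱ d<p)

  private
    ≤∧≋⇒≡ : ∀ {x y} → y ≤ x → x < p → + x ≋ + y → x ≡ y
    ≤∧≋⇒≡ {x} {y} y≤x x<p (multiple {z} _ x-y≡pz) = ℕP.≤-antisym (ℕP.m∸n≡0⇒m≤n x∸y≡0) y≤x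
      where
      x∸y≡0 : x ℕ.∸ y ≡ 0
      x∸y≡0 = multiple<p⇒0 z (ℕP.≤-<-trans (ℕP.m∸n≤m x y) x<p)
        (trans (sym (ℤP.⊖-≥ y≤x)) (trans (sym (ℤP.m-n≡m⊖n x y)) x-y≡pz))

  ≋⇒≡ : ∀ {x y} → x < p → y < p → + x ≋ + y → x ≡ y
  ≋⇒≡ {x} {y} x<p y<p x≋y with ℕP.≤-total y x
  ... | inj₁ y≤x = ≤∧≋⇒≡ y≤x x<p x≋y
  ... | inj₂ x≤y = sym (≤∧≋⇒≡ x≤y y<p (≋-sym x≋y))

  +p≋ : ∀ a → + (a ℕ.+ p) ≋ + a
  +p≋ a = multiple {quotient = + 1} tt (begin
    + (a ℕ.+ p) ℤ.- + a        ≡⟨ cong (ℤ._- + a) (ℤP.pos-+ a p) ⟩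
    + a ℤ.+ + p ℤ.- + a        ≡⟨ solve 2 (λ a p → a :+ p :- a := p :* con (+ 1)) refl (+ a) (+ p) ⟩
    + p ℤ.* + 1                ∎)
    where
    open ≡-Reasoning
    open +-*-Solver

  product-paired : ∀ (σ : ℕ → ℕ) xs → Unique xs →
    (∀ {a} → a ∈ xs → σ a ∈ xs) → (∀ {a} → a ∈ xs → σ a ≢ a) →
    (∀ {a} → a ∈ xs → σ (σ a) ≡ a) → (∀ {a} → a ∈ xs → + a ℤ.* + σ a ≋ + 1) →
    + product xs ≋ + 1
  product-paired σ xs xs! closed fixed-point-free involutive cancels =
    cancel-pairs (length xs) xs ℕP.≤-refl (λ a∈xs → a∈xs) xs! closed
    where
    cancel-pairs : ∀ n ys → length ys ≤ n → (∀ {a} → a ∈ ys → a ∈ xs) → Unique ys →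
      (∀ {a} → a ∈ ys → σ a ∈ ys) → + product ys ≋ + 1
    cancel-pairs n       []       _             _    _             _      = ≈⇒≋ refl
    cancel-pairs (suc n) (a ∷ ys) (s≤s |ys|≤n) ⊆xs (a∉ys ∷ ys!) closedᵧ
      with closedᵧ (here refl)
    ... | here σa≡a  = contradiction σa≡a (fixed-point-free (⊆xs (here refl)))
    ... | there b∈ys = ≋-trans (≈⇒≋ product≡) (≋-trans (*-congʳ≋ tt (cancels (⊆xs (here refl))))
                         (≋-trans (≈⇒≋ (ℤP.*-identityˡ (+ product zs))) (cancel-pairs n zs |zs|≤n ⊆xs′ zs! closed′)))
      where
      b = σ a
      ≢b? = λ x → ¬? (x ℕ.≟ b)
      zs = filter ≢b? ys
      product≡ : + product (a ∷ ys) ≡ + a ℤ.* + b ℤ.* + product zs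
      product≡ = trans (cong (λ m → + (a ℕ.* m)) (product-remove ys b∈ys ys!))
        (trans (cong +_ (sym (ℕP.*-assoc a b _))) (trans (ℤP.pos-* (a ℕ.* b) _) (cong (ℤ._* + product zs) (ℤP.pos-* a b))))
      |zs|≤n : length zs ≤ n
      |zs|≤n = ℕP.≤-trans (ListP.length-filter ≢b? ys) |ys|≤n
      ⊆xs′ : ∀ {c} → c ∈ zs → c ∈ xs
      ⊆xs′ c∈zs = ⊆xs (there (proj₁ (∈-filter⁻ ≢b? c∈zs)))
      zs! : Unique zs
      zs! = UniqueP.filter⁺ ≢b? ys!
      closed′ : ∀ {c} → c ∈ zs → σ c ∈ zs
      closed′ {c} c∈zs with ∈-filter⁻ ≢b? c∈zs
      ... | c∈ys , c≢b with closedᵧ (there c∈ys)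
      ...   | here σc≡a   = contradiction (trans (sym (involutive (⊆xs (there c∈ys)))) (cong σ σc≡a)) c≢b
      ...   | there σc∈ys = ∈-filter⁺ ≢b? σc∈ys σc≢b
        where
        σc≢b : σ c ≢ b
        σc≢b σc≡b = lookup a∉ys c∈ys (sym (trans (sym (involutive (⊆xs (there c∈ys))))
          (trans (cong σ σc≡b) (involutive (⊆xs (here refl))))))

module Wilson {p : ℕ} (p-prime : Prime p) where
  open IntegersModulo p

  private
    instance
      p≢0 : NonZero p
      p≢0 = prime⇒nonZero p-prime

    1<p : 1 < p
    1<p = ℕ.nonTrivial⇒n>1 p {{prime⇒nonTrivial p-prime}}

  1≉0 : ¬ (+ 1 ≋ + 0)
  1≉0 1≋0 with () ← ≋⇒≡ 1<p (ℕP.<-trans (s≤s z≤n) 1<p) 1≋0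

  p-1≋-1 : + (p ℕ.∸ 1) ≋ ℤ.- + 1
  p-1≋-1 = multiple {quotient = + 1} tt (begin
    + (p ℕ.∸ 1) ℤ.+ ℤ.- ℤ.- + 1   ≡⟨ ℤP.pos-+ (p ℕ.∸ 1) 1 ⟨
    + (p ℕ.∸ 1 ℕ.+ 1)             ≡⟨ cong +_ (ℕP.m∸n+n≡m (ℕP.<⇒≤ 1<p)) ⟩
    + p                          ≡⟨ ℤP.*-identityʳ (+ p) ⟨
    + p ℤ.* + 1                  ∎)
    where open ≡-Reasoning

  ∣⇒≋0 : ∀ a → p ∣ ℤ.∣ a ∣ → a ≋ + 0
  ∣⇒≋0 (+ m) (divides q m≡q*p) = multiple {quotient = + q} tt (begin
    + m ℤ.+ + 0            ≡⟨ ℤP.+-identityʳ (+ m) ⟩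
    + m                    ≡⟨ cong +_ (trans m≡q*p (ℕP.*-comm q p)) ⟩
    + (p ℕ.* q)            ≡⟨ ℤP.pos-* p q ⟩
    + p ℤ.* + q            ∎)
    where open ≡-Reasoning
  ∣⇒≋0 -[1+ m ] (divides q 1+m≡q*p) = multiple {quotient = ℤ.- + q} tt (begin
    -[1+ m ] ℤ.+ + 0       ≡⟨ ℤP.+-identityʳ -[1+ m ] ⟩
    ℤ.- + suc m            ≡⟨ cong (λ t → ℤ.- + t) (trans 1+m≡q*p (ℕP.*-comm q p)) ⟩
    ℤ.- + (p ℕ.* q)        ≡⟨ cong ℤ.-_ (ℤP.pos-* p q) ⟩
    ℤ.- (+ p ℤ.* + q)      ≡⟨ ℤP.neg-distribʳ-* (+ p) (+ q) ⟩
    + p ℤ.* ℤ.- + q        ∎)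
    where open ≡-Reasoning

  *≋0⇒≋0 : ∀ a b → a ℤ.* b ≋ + 0 → a ≋ + 0 ⊎ b ≋ + 0
  *≋0⇒≋0 a b (multiple {z} _ ab-0≡p*z)
    with euclidsLemma ℤ.∣ a ∣ ℤ.∣ b ∣ p-prime (divides ℤ.∣ z ∣ (begin
      ℤ.∣ a ∣ ℕ.* ℤ.∣ b ∣         ≡⟨ ℤP.abs-* a b ⟨
      ℤ.∣ a ℤ.* b ∣               ≡⟨ cong ℤ.∣_∣ (trans (sym (ℤP.+-identityʳ (a ℤ.* b))) ab-0≡p*z) ⟩
      ℤ.∣ + p ℤ.* z ∣             ≡⟨ ℤP.abs-* (+ p) z ⟩
      p ℕ.* ℤ.∣ z ∣               ≡⟨ ℕP.*-comm p ℤ.∣ z ∣ ⟩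
      ℤ.∣ z ∣ ℕ.* p               ∎))
    where open ≡-Reasoning
  ... | inj₁ p∣a = inj₁ (∣⇒≋0 a p∣a)
  ... | inj₂ p∣b = inj₂ (∣⇒≋0 b p∣b)

  -- Abstract, so that type checking never unfolds the extended Euclidean algorithm.
  abstract
    private
      bézout-coefficient : ℕ → ℤ
      bézout-coefficient a with Bézout.lemma a p
      ... | Bézout.result _ _ (Bézout.+- x _ _) = + x
      ... | Bézout.result _ _ (Bézout.-+ x _ _) = ℤ.- + x

      *-bézout-coefficient : ∀ {a} → 1 ≤ a → a < p → + a ℤ.* bézout-coefficient a ≋ + 1
      *-bézout-coefficient {a} 1≤a a<p with Bézout.lemma a p
      ... | Bézout.result d gcd≡d identity
        with refl ← GCD.unique gcd≡d (coprime⇒GCD≡1 (Coprimality.sym (prime⇒coprime p-prime {{ℕ.>-nonZero 1≤a}} a<p)))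
        with identity
      ... | Bézout.+- x y 1+y*p≡x*a = multiple {quotient = + y} tt (begin
        + a ℤ.* + x ℤ.- + 1            ≡⟨ cong (ℤ._- + 1) (trans (sym (ℤP.pos-* a x)) (cong +_ (trans (ℕP.*-comm a x) (sym 1+y*p≡x*a)))) ⟩
        + (1 ℕ.+ y ℕ.* p) ℤ.- + 1      ≡⟨ cong (ℤ._- + 1) (trans (ℤP.pos-+ 1 (y ℕ.* p)) (cong (ℤ._+_ (+ 1)) (ℤP.pos-* y p))) ⟩
        + 1 ℤ.+ + y ℤ.* + p ℤ.- + 1    ≡⟨ solve 2 (λ y p → con (+ 1) :+ y :* p :- con (+ 1) := p :* y) refl (+ y) (+ p) ⟩
        + p ℤ.* + y                    ∎)
        where
        open ≡-Reasoning
        open +-*-Solver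
      ... | Bézout.-+ x y 1+x*a≡y*p = multiple {quotient = ℤ.- + y} tt (begin
        + a ℤ.* ℤ.- + x ℤ.- + 1         ≡⟨ solve 2 (λ a x → a :* :- x :- con (+ 1) := :- (con (+ 1) :+ x :* a)) refl (+ a) (+ x) ⟩
        ℤ.- (+ 1 ℤ.+ + x ℤ.* + a)       ≡⟨ cong ℤ.-_ (trans (ℤP.pos-+ 1 (x ℕ.* a)) (cong (ℤ._+_ (+ 1)) (ℤP.pos-* x a))) ⟨
        ℤ.- + (1 ℕ.+ x ℕ.* a)           ≡⟨ cong (λ t → ℤ.- + t) 1+x*a≡y*p ⟩
        ℤ.- + (y ℕ.* p)                 ≡⟨ cong ℤ.-_ (ℤP.pos-* y p) ⟩
        ℤ.- (+ y ℤ.* + p)               ≡⟨ solve 2 (λ y p → :- (y :* p) := p :* :- y) refl (+ y) (+ p) ⟩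
        + p ℤ.* ℤ.- + y                 ∎)
        where
        open ≡-Reasoning
        open +-*-Solver

    inverse : ℕ → ℕ
    inverse a = bézout-coefficient a ℤ.%ℕ p

    inverse<p : ∀ a → inverse a < p
    inverse<p a = n%ℕd<d (bézout-coefficient a) p

    *-inverse : ∀ {a} → 1 ≤ a → a < p → + a ℤ.* + inverse a ≋ + 1
    *-inverse {a} 1≤a a<p = ≋-trans (*-congˡ≋ {+ a} tt residue≋) (*-bézout-coefficient 1≤a a<p)
      where
      c : ℤ
      c = bézout-coefficient a
      residue≋ : + inverse a ≋ c
      residue≋ = multiple {quotient = ℤ.- (c ℤ./ℕ p)} tt (begin
        + inverse a ℤ.- c                                    ≡⟨ cong (ℤ._-_ (+ inverse a)) (a≡a%ℕn+[a/ℕn]*n c p) ⟩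
        + inverse a ℤ.- (+ inverse a ℤ.+ (c ℤ./ℕ p) ℤ.* + p) ≡⟨ solve 3 (λ r q p → r :- (r :+ q :* p) := p :* :- q) refl (+ inverse a) (c ℤ./ℕ p) (+ p) ⟩
        + p ℤ.* ℤ.- (c ℤ./ℕ p)                               ∎)
        where
        open ≡-Reasoning
        open +-*-Solver

  1≤inverse : ∀ {a} → 1 ≤ a → a < p → 1 ≤ inverse a
  1≤inverse {a} 1≤a a<p with inverse a | *-inverse 1≤a a<p
  ... | zero  | a*0≋1 = contradiction (≋-sym (≋-trans (≈⇒≋ (sym (ℤP.*-zeroʳ (+ a)))) a*0≋1)) 1≉0
  ... | suc _ | _     = s≤s z≤n

  inverse-involutive : ∀ {a} → 1 ≤ a → a < p → inverse (inverse a) ≡ a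
  inverse-involutive {a} 1≤a a<p = ≋⇒≡ (inverse<p (inverse a)) a<p
    (inverse-unique≋ tt tt tt (≋-trans (≈⇒≋ (ℤP.*-comm (+ inverse (inverse a)) (+ inverse a)))
      (*-inverse (1≤inverse 1≤a a<p) (inverse<p a))) (≋-trans (≈⇒≋ (ℤP.*-comm (+ inverse a) (+ a))) (*-inverse 1≤a a<p)))

  private
    ≋-1⇒≡p-1 : ∀ {a} → a < p → + a ≋ ℤ.- + 1 → a ≡ p ℕ.∸ 1
    ≋-1⇒≡p-1 a<p a≋-1 = ≋⇒≡ a<p (ℕP.∸-monoʳ-< (s≤s z≤n) (ℕP.<⇒≤ 1<p)) (≋-trans a≋-1 (≋-sym p-1≋-1))

    ≢p-1 : ∀ {a} → suc a < p → a ≢ p ℕ.∸ 1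
    ≢p-1 {a} 1+a<p refl = ℕP.<-irrefl (ℕP.m∸n+n≡m (ℕP.<⇒≤ 1<p)) (subst (_< p) (ℕP.+-comm 1 a) 1+a<p)

  square≋1⇒≋±1 : ∀ a → a ℤ.* a ≋ + 1 → a ≋ + 1 ⊎ a ≋ ℤ.- + 1
  square≋1⇒≋±1 a a²≋1 with *≋0⇒≋0 (a ℤ.- + 1) (a ℤ.+ + 1)
    (≋-trans (≈⇒≋ (solve 1 (λ a → (a :- con (+ 1)) :* (a :+ con (+ 1)) := a :* a :+ :- con (+ 1)) refl a))
             (+-cong≋ {y′ = ℤ.- + 1} a²≋1 (≈⇒≋ refl)))
    where open +-*-Solver
  ... | inj₁ a-1≋0 = inj₁ (≋-trans (≈⇒≋ (solve 1 (λ a → a := a :- con (+ 1) :+ con (+ 1)) refl a))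
                                   (+-cong≋ {y′ = + 1} a-1≋0 (≈⇒≋ refl)))
    where open +-*-Solver
  ... | inj₂ a+1≋0 = inj₂ (≋-trans (≈⇒≋ (solve 1 (λ a → a := a :+ con (+ 1) :+ :- con (+ 1)) refl a))
                                   (+-cong≋ {y′ = ℤ.- + 1} a+1≋0 (≈⇒≋ refl)))
    where open +-*-Solver

  inverse≢self : ∀ {a} → 2 ≤ a → suc a < p → inverse a ≢ a
  inverse≢self {a} 2≤a 1+a<p a⁻¹≡a
    with square≋1⇒≋±1 (+ a) (subst (λ b → + a ℤ.* + b ≋ + 1) a⁻¹≡a (*-inverse (ℕP.<-trans (s≤s z≤n) 2≤a) a<p))
    where a<p = ℕP.<-trans (ℕP.n<1+n a) 1+a<p
  ... | inj₁ a≋1  = ℕP.<-irrefl (sym (≋⇒≡ (ℕP.<-trans (ℕP.n<1+n a) 1+a<p) 1<p a≋1)) 2≤a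
  ... | inj₂ a≋-1 = ≢p-1 1+a<p (≋-1⇒≡p-1 (ℕP.<-trans (ℕP.n<1+n a) 1+a<p) a≋-1)

  2≤inverse : ∀ {a} → 2 ≤ a → suc a < p → 2 ≤ inverse a
  2≤inverse {a} 2≤a 1+a<p = ℕP.≤∧≢⇒< (1≤inverse 1≤a a<p) 1≢inverse
    where
    1≤a = ℕP.<-trans (s≤s z≤n) 2≤a
    a<p = ℕP.<-trans (ℕP.n<1+n a) 1+a<p
    1≢inverse : 1 ≢ inverse a
    1≢inverse 1≡a⁻¹ = ℕP.<-irrefl (sym (≋⇒≡ a<p 1<p a≋1)) 2≤a
      where
      a≋1 : + a ≋ + 1
      a≋1 = ≋-trans (≈⇒≋ (sym (ℤP.*-identityʳ (+ a)))) (subst (λ b → + a ℤ.* + b ≋ + 1) (sym 1≡a⁻¹) (*-inverse 1≤a a<p))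

  inverse<p-1 : ∀ {a} → 2 ≤ a → suc a < p → suc (inverse a) < p
  inverse<p-1 {a} 2≤a 1+a<p = ℕP.≤∧≢⇒< (inverse<p a) (λ 1+a⁻¹≡p → ≢p-1 1+a<p (≋-1⇒≡p-1 a<p (a≋-1 1+a⁻¹≡p)))
    where
    1≤a = ℕP.<-trans (s≤s z≤n) 2≤a
    a<p = ℕP.<-trans (ℕP.n<1+n a) 1+a<p
    a≋-1 : suc (inverse a) ≡ p → + a ≋ ℤ.- + 1
    a≋-1 1+a⁻¹≡p = ≋-trans (≈⇒≋ (sym (ℤP.neg-involutive (+ a)))) (-‿cong≋ -a≋1)
      where
      open +-*-Solver
      -a≋1 : ℤ.- + a ≋ + 1
      -a≋1 = ≋-trans (≈⇒≋ (solve 1 (λ a → :- a := a :* :- con (+ 1)) refl (+ a)))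
        (≋-trans (*-congˡ≋ {+ a} tt (≋-sym p-1≋-1))
          (subst (λ b → + a ℤ.* + b ≋ + 1) (cong ℕ.pred 1+a⁻¹≡p) (*-inverse 1≤a a<p)))

product-applyDownFrom-2+ : ∀ k → product (applyDownFrom (2 ℕ.+_) k) ≡ suc k !
product-applyDownFrom-2+ zero    = refl
product-applyDownFrom-2+ (suc k) = cong (suc (suc k) ℕ.*_) (product-applyDownFrom-2+ k)

-- The residues 2, …, p − 2 pair off with their inverses, leaving (p − 1)! ≡ p − 1.
wilson : ∀ {p} → Prime p → IntegersModulo._≋_ p (+ ((p ℕ.∸ 1) !)) (ℤ.- + 1)
wilson {0} p-prime with () ← ℕ.nonTrivial⇒n>1 0 {{prime⇒nonTrivial p-prime}}
wilson {1} p-prime with s≤s () ← ℕ.nonTrivial⇒n>1 1 {{prime⇒nonTrivial p-prime}}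
wilson {2} _ = IntegersModulo.multiple {quotient = + 1} tt refl
wilson {suc (suc (suc k))} p-prime =
  ≋-trans (≈⇒≋ (trans (cong +_ (cong (suc (suc k) ℕ.*_) (sym (product-applyDownFrom-2+ k)))) (ℤP.pos-* (suc (suc k)) (product range))))
    (≋-trans (*-congʳ≋ {+ product range} tt p-1≋-1) (*-congˡ≋ {ℤ.- + 1} tt product-range≋1))
  where
  open IntegersModulo (suc (suc (suc k)))
  open Wilson p-prime
  range : List ℕ
  range = applyDownFrom (2 ℕ.+_) k
  ∈range⁻ : ∀ {a} → a ∈ range → 2 ≤ a × suc a < suc (suc (suc k))
  ∈range⁻ a∈range with i , i<k , refl ← ∈-applyDownFrom⁻ (2 ℕ.+_) a∈range = s≤s (s≤s z≤n) , s≤s (s≤s (s≤s i<k))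
  ∈range⁺ : ∀ {a} → 2 ≤ a → suc a < suc (suc (suc k)) → a ∈ range
  ∈range⁺ {suc (suc i)} _ (s≤s (s≤s (s≤s i<k))) = ∈-applyDownFrom⁺ (2 ℕ.+_) i<k
  ∈range⁺ {suc zero} (s≤s ()) _
  product-range≋1 : + product range ≋ + 1
  product-range≋1 = product-paired inverse range
    (UniqueP.applyDownFrom⁺₁ (2 ℕ.+_) k (λ j<i _ i≡j → ℕP.<-irrefl (sym (ℕP.+-cancelˡ-≡ 2 _ _ i≡j)) j<i))
    (λ a∈ → let 2≤a , 1+a<p = ∈range⁻ a∈ in ∈range⁺ (2≤inverse 2≤a 1+a<p) (inverse<p-1 2≤a 1+a<p))
    (λ a∈ → let 2≤a , 1+a<p = ∈range⁻ a∈ in inverse≢self 2≤a 1+a<p)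
    (λ a∈ → let 2≤a , 1+a<p = ∈range⁻ a∈ in inverse-involutive (ℕP.<-trans (s≤s z≤n) 2≤a) (ℕP.<-trans (ℕP.n<1+n _) 1+a<p))
    (λ a∈ → let 2≤a , 1+a<p = ∈range⁻ a∈ in *-inverse (ℕP.<-trans (s≤s z≤n) 2≤a) (ℕP.<-trans (ℕP.n<1+n _) 1+a<p))

evens : ℕ → ℕ
evens zero    = 1
evens (suc k) = evens k ℕ.* (2 ℕ.* suc k)

odds : ℕ → ℕ
odds zero    = 1
odds (suc k) = odds k ℕ.* suc (2 ℕ.* k)

evens*odds≡! : ∀ k → evens k ℕ.* odds k ≡ (k ℕ.+ k) !
evens*odds≡! zero    = refl
evens*odds≡! (suc k) = begin
  evens k ℕ.* (2 ℕ.* suc k) ℕ.* (odds k ℕ.* suc (2 ℕ.* k))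
    ≡⟨ solve 3 (λ e o k → e :* (con 2 :* (con 1 :+ k)) :* (o :* (con 1 :+ con 2 :* k))
                       := (con 2 :+ (k :+ k)) :* ((con 1 :+ (k :+ k)) :* (e :* o))) refl (evens k) (odds k) k ⟩
  suc (suc (k ℕ.+ k)) ℕ.* (suc (k ℕ.+ k) ℕ.* (evens k ℕ.* odds k))
    ≡⟨ cong (λ t → suc (suc (k ℕ.+ k)) ℕ.* (suc (k ℕ.+ k) ℕ.* t)) (evens*odds≡! k) ⟩
  suc (suc (k ℕ.+ k)) !
    ≡⟨ cong (λ t → suc t !) (ℕP.+-suc k k) ⟨
  (suc k ℕ.+ suc k) !  ∎
  where
  open ≡-Reasoning
  open Data.Nat.Solver.+-*-Solver

-- Modulo p = 2n + 1 the factor 2 (n + m + 1) of evens (n + n) is congruent to 2m + 1,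
-- so evens (n + n) ≡ evens n · odds n = (p − 1)!.
evens≋-1 : ∀ {n} → Prime (suc (n ℕ.+ n)) → IntegersModulo._≋_ (suc (n ℕ.+ n)) (+ evens (n ℕ.+ n)) (ℤ.- + 1)
evens≋-1 {n} p-prime = ≋-trans (evens[n+m]≋ n) (≋-trans (≈⇒≋ (cong +_ (evens*odds≡! n))) (wilson p-prime))
  where
  open IntegersModulo (suc (n ℕ.+ n))
  evens[n+m]≋ : ∀ m → + evens (n ℕ.+ m) ≋ + (evens n ℕ.* odds m)
  evens[n+m]≋ zero    = ≈⇒≋ (cong +_ (trans (cong evens (ℕP.+-identityʳ n)) (sym (ℕP.*-identityʳ (evens n)))))
  evens[n+m]≋ (suc m) = ≋-trans (≈⇒≋ (trans (cong (λ t → + evens t) (ℕP.+-suc n m)) (ℤP.pos-* (evens (n ℕ.+ m)) _)))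
    (≋-trans (*-cong≋ tt tt (evens[n+m]≋ m) 2[n+m+1]≋2m+1)
      (≈⇒≋ (trans (sym (ℤP.pos-* (evens n ℕ.* odds m) _)) (cong +_ (ℕP.*-assoc (evens n) (odds m) _)))))
    where
    2[n+m+1]≋2m+1 : + (2 ℕ.* suc (n ℕ.+ m)) ≋ + suc (2 ℕ.* m)
    2[n+m+1]≋2m+1 = ≋-trans (≈⇒≋ (cong +_ (solve 2 (λ n m → con 2 :* (con 1 :+ (n :+ m)) := (con 1 :+ con 2 :* m) :+ (con 1 :+ (n :+ n))) refl n m)))
      (+p≋ (suc (2 ℕ.* m)))
      where open Data.Nat.Solver.+-*-Solver

private
  sub-suc : ∀ z i → z ℤ.- + suc i ≡ (z ℤ.- + 1) ℤ.- + i
  sub-suc z i = solve 2 (λ z i → z :- (con (+ 1) :+ i) := (z :- con (+ 1)) :- i) refl z (+ i)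
    where open +-*-Solver

  sub-sub-comm : ∀ z i j → (z ℤ.- i) ℤ.- j ≡ (z ℤ.- j) ℤ.- i
  sub-sub-comm = solve 3 (λ z i j → (z :- i) :- j := (z :- j) :- i) refl
    where open +-*-Solver

  sub-split : ∀ z i j → z ℤ.- i ≡ (z ℤ.- j) ℤ.- i ℤ.+ j
  sub-split = solve 3 (λ z i j → z :- i := (z :- j) :- i :+ j) refl
    where open +-*-Solver

  index-column : ∀ k {t} → t ≤ 7 → + k ℤ.+ + (7 ℕ.∸ t) ℤ.- + 7 ≡ + suc k ℤ.- + suc t
  index-column k {t} t≤7 = trans (cong (λ w → + k ℤ.+ w ℤ.- + 7) (trans (sym (ℤP.⊖-≥ t≤7)) (sym (ℤP.m-n≡m⊖n 7 t))))
    (solve 2 (λ k t → k :+ (con (+ 7) :- t) :- con (+ 7) := (con (+ 1) :+ k) :- (con (+ 1) :+ t)) refl (+ k) (+ t))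
    where open +-*-Solver

  index-shift : ∀ k j → + k ℤ.+ + suc j ℤ.- + 7 ≡ + suc k ℤ.+ + j ℤ.- + 7
  index-shift k j = solve 2 (λ k j → k :+ (con (+ 1) :+ j) :- con (+ 7) := (con (+ 1) :+ k) :+ j :- con (+ 7)) refl (+ k) (+ j)
    where open +-*-Solver

  index-below : ∀ {t} → t < 7 → + t ℤ.- + 7 ≡ -[1+ 6 ℕ.∸ t ]
  index-below {t} t<7 = trans (ℤP.m-n≡m⊖n t 7) (trans (ℤP.⊖-< t<7) (cong (λ w → ℤ.- + w) (ℕP.+-∸-assoc 1 (ℕP.≤-pred t<7))))

  index-last : ∀ k → + k ℤ.+ + 7 ℤ.- + 7 ≡ + k
  index-last k = solve 1 (λ k → k :+ con (+ 7) :- con (+ 7) := k) refl (+ k)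
    where open +-*-Solver

  2≤2n : ∀ {p n} → 1 < p → p ≡ suc (n ℕ.+ n) → 2 ≤ n ℕ.+ n
  2≤2n {n = zero}  1<p refl = contradiction 1<p (ℕP.<-irrefl refl)
  2≤2n {n = suc k} _   _    = s≤s (subst (1 ≤_) (sym (ℕP.+-suc k k)) (s≤s z≤n))

  index-from-top : ∀ {q d} j → j ℕ.+ d ≡ 7 → d ℕ.≤ q → + q ℤ.+ + j ℤ.- + 7 ≡ + (q ℕ.∸ d)
  index-from-top {q} {d} j j+d≡7 d≤q = begin
    + q ℤ.+ + j ℤ.- + 7                ≡⟨ cong (λ t → + q ℤ.+ + j ℤ.- + t) j+d≡7 ⟨
    + q ℤ.+ + j ℤ.- + (j ℕ.+ d)        ≡⟨ solve 3 (λ q j d → q :+ j :- (j :+ d) := q :- d) refl (+ q) (+ j) (+ d) ⟩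
    + q ℤ.- + d                        ≡⟨ trans (ℤP.m-n≡m⊖n q d) (ℤP.⊖-≥ d≤q) ⟩
    + (q ℕ.∸ d)                        ∎
    where
    open ≡-Reasoning
    open +-*-Solver

-- Finite sums and the coefficients of powers of a polynomial

module _ (D : ℤ) where
  open CommutativeRing (quadraticRing D) using (_+_; _*_; -_; _-_; 0#; 1#; +-identityˡ; +-identityʳ; *-comm; *-assoc; zeroʳ; zeroˡ; distribˡ; distribʳ)
  open K-Solver D using (solve; _:+_; _:*_; :-_; _:-_; _:=_; con)

  sumFin-cong : ∀ {n} {f g : Fin n → QF} → (∀ i → f i ≡ g i) → sumFin f ≡ sumFin g
  sumFin-cong {zero}  f≗g = refl
  sumFin-cong {suc n} f≗g = cong₂ _+_ (f≗g zero) (sumFin-cong (f≗g ∘ suc))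

  sumFin-zero : ∀ {n} → sumFin {n} (λ _ → 0#) ≡ 0#
  sumFin-zero {zero}  = refl
  sumFin-zero {suc n} = trans (cong (_+_ 0#) (sumFin-zero {n})) (+-identityˡ 0#)

  sumFin-+ : ∀ {n} (f g : Fin n → QF) → sumFin (λ i → f i + g i) ≡ sumFin f + sumFin g
  sumFin-+ {zero}  f g = sym (+-identityˡ 0#)
  sumFin-+ {suc n} f g = trans (cong (_+_ (f zero + g zero)) (sumFin-+ (f ∘ suc) (g ∘ suc)))
    (solve 4 (λ a b c d → (a :+ b) :+ (c :+ d) := (a :+ c) :+ (b :+ d)) refl (f zero) (g zero) (sumFin (f ∘ suc)) (sumFin (g ∘ suc)))

  *-distribˡ-sumFin : ∀ {n} c (f : Fin n → QF) → c * sumFin f ≡ sumFin (λ i → c * f i)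
  *-distribˡ-sumFin {zero}  c f = zeroʳ c
  *-distribˡ-sumFin {suc n} c f = trans (distribˡ c (f zero) (sumFin (f ∘ suc))) (cong (_+_ (c * f zero)) (*-distribˡ-sumFin c (f ∘ suc)))

  sumFin-swap : ∀ {m n} (f : Fin m → Fin n → QF) → sumFin (λ i → sumFin (f i)) ≡ sumFin (λ j → sumFin (λ i → f i j))
  sumFin-swap {zero}  {n} f = sym (sumFin-zero {n})
  sumFin-swap {suc m} {n} f = trans (cong (_+_ (sumFin (f zero))) (sumFin-swap (f ∘ suc)))
    (sym (sumFin-+ (f zero) (λ j → sumFin (λ i → f (suc i) j))))

  sumFin-linear : ∀ {n} c d (f g : Fin n → QF) → sumFin (λ i → c * f i + d * g i) ≡ c * sumFin f + d * sumFin g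
  sumFin-linear c d f g = trans (sumFin-+ (λ i → c * f i) (λ i → d * g i))
    (sym (cong₂ _+_ (*-distribˡ-sumFin c f) (*-distribˡ-sumFin d g)))

  coeffℤ : Poly → ℤ → QF
  coeffℤ f (+ n)    = coeff f n
  coeffℤ f -[1+ n ] = 0#

  coeffℤ-[] : ∀ z → coeffℤ [] z ≡ 0#
  coeffℤ-[] (+ n)    = refl
  coeffℤ-[] -[1+ n ] = refl

  coeffℤ-polyAdd : ∀ f g z → coeffℤ (polyAdd f g) z ≡ coeffℤ f z + coeffℤ g z
  coeffℤ-polyAdd f g -[1+ n ] = sym (+-identityˡ 0#)
  coeffℤ-polyAdd []      g       (+ n)     = sym (+-identityˡ (coeff g n))
  coeffℤ-polyAdd (a ∷ f) []      (+ n)     = sym (+-identityʳ (coeff (a ∷ f) n))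
  coeffℤ-polyAdd (a ∷ f) (b ∷ g) (+ zero)  = refl
  coeffℤ-polyAdd (a ∷ f) (b ∷ g) (+ suc n) = coeffℤ-polyAdd f g (+ n)

  coeffℤ-polyScale : ∀ c f z → coeffℤ (polyScale D c f) z ≡ c * coeffℤ f z
  coeffℤ-polyScale c f       -[1+ n ]  = sym (zeroʳ c)
  coeffℤ-polyScale c []      (+ n)     = sym (zeroʳ c)
  coeffℤ-polyScale c (a ∷ f) (+ zero)  = refl
  coeffℤ-polyScale c (a ∷ f) (+ suc n) = coeffℤ-polyScale c f (+ n)

  coeffℤ-∷ : ∀ a f z → coeffℤ (a ∷ f) z ≡ coeffℤ (a ∷ []) z + coeffℤ f (z ℤ.- + 1)
  coeffℤ-∷ a f (+ zero)  = sym (+-identityʳ a)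
  coeffℤ-∷ a f (+ suc n) = sym (+-identityˡ (coeff f n))
  coeffℤ-∷ a f -[1+ n ]  = sym (+-identityˡ 0#)

  private
    coeffℤ-[a]*b : ∀ a b z → coeffℤ (a ∷ []) z * b ≡ a * coeffℤ (b ∷ []) z
    coeffℤ-[a]*b a b (+ zero)  = refl
    coeffℤ-[a]*b a b (+ suc n) = trans (zeroˡ b) (sym (zeroʳ a))
    coeffℤ-[a]*b a b -[1+ n ]  = trans (zeroˡ b) (sym (zeroʳ a))

  polyScale-tabulate : ∀ {n} a (h : Fin n → QF) z →
    sumFin (λ i → coeffℤ (a ∷ []) (z ℤ.- + toℕ i) * h i) ≡ a * coeffℤ (tabulate h) z
  polyScale-tabulate {zero}  a h z = sym (trans (cong (a *_) (coeffℤ-[] z)) (zeroʳ a))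
  polyScale-tabulate {suc n} a h z = begin
    coeffℤ (a ∷ []) (z ℤ.- + 0) * h zero + sumFin (λ i → coeffℤ (a ∷ []) (z ℤ.- + suc (toℕ i)) * h (suc i))
      ≡⟨ cong₂ _+_ (cong (λ w → coeffℤ (a ∷ []) w * h zero) (ℤP.+-identityʳ z))
                    (sumFin-cong (λ i → cong (λ w → coeffℤ (a ∷ []) w * h (suc i)) (sub-suc z (toℕ i)))) ⟩
    coeffℤ (a ∷ []) z * h zero + sumFin (λ i → coeffℤ (a ∷ []) ((z ℤ.- + 1) ℤ.- + toℕ i) * h (suc i))
      ≡⟨ cong₂ _+_ (coeffℤ-[a]*b a (h zero) z) (polyScale-tabulate a (h ∘ suc) (z ℤ.- + 1)) ⟩
    a * coeffℤ (h zero ∷ []) z + a * coeffℤ (tabulate (h ∘ suc)) (z ℤ.- + 1)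
      ≡⟨ distribˡ a _ _ ⟨
    a * (coeffℤ (h zero ∷ []) z + coeffℤ (tabulate (h ∘ suc)) (z ℤ.- + 1))
      ≡⟨ cong (a *_) (coeffℤ-∷ (h zero) (tabulate (h ∘ suc)) z) ⟨
    a * coeffℤ (tabulate h) z ∎
    where open ≡-Reasoning

  coeffℤ-polyMul-tabulate : ∀ {n} f (h : Fin n → QF) z →
    coeffℤ (polyMul D f (tabulate h)) z ≡ sumFin (λ i → coeffℤ f (z ℤ.- + toℕ i) * h i)
  coeffℤ-polyMul-tabulate [] h z = trans (coeffℤ-[] z)
    (sym (trans (sumFin-cong (λ i → trans (cong (_* h i) (coeffℤ-[] (z ℤ.- + toℕ i))) (zeroˡ (h i)))) sumFin-zero))
  coeffℤ-polyMul-tabulate (a ∷ f) h z = begin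
    coeffℤ (polyAdd (polyScale D a H) (0# ∷ polyMul D f H)) z
      ≡⟨ coeffℤ-polyAdd (polyScale D a H) (0# ∷ polyMul D f H) z ⟩
    coeffℤ (polyScale D a H) z + coeffℤ (0# ∷ polyMul D f H) z
      ≡⟨ cong₂ _+_ (coeffℤ-polyScale a H z) (trans (coeffℤ-∷ 0# (polyMul D f H) z)
                    (trans (cong (_+ coeffℤ (polyMul D f H) (z ℤ.- + 1)) (coeffℤ-[0] z)) (+-identityˡ _))) ⟩
    a * coeffℤ H z + coeffℤ (polyMul D f H) (z ℤ.- + 1)
      ≡⟨ cong₂ _+_ (polyScale-tabulate a h z) (sym (coeffℤ-polyMul-tabulate f h (z ℤ.- + 1))) ⟨
    sumFin (λ i → coeffℤ (a ∷ []) (z ℤ.- + toℕ i) * h i) + sumFin (λ i → coeffℤ f ((z ℤ.- + 1) ℤ.- + toℕ i) * h i)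
      ≡⟨ sumFin-+ _ _ ⟨
    sumFin (λ i → coeffℤ (a ∷ []) (z ℤ.- + toℕ i) * h i + coeffℤ f ((z ℤ.- + 1) ℤ.- + toℕ i) * h i)
      ≡⟨ sumFin-cong (λ i → trans (sym (distribʳ (h i) (coeffℤ (a ∷ []) (z ℤ.- + toℕ i)) (coeffℤ f ((z ℤ.- + 1) ℤ.- + toℕ i))))
           (cong (_* h i) (sym (trans (coeffℤ-∷ a f (z ℤ.- + toℕ i))
           (cong (λ w → coeffℤ (a ∷ []) (z ℤ.- + toℕ i) + coeffℤ f w) (sub-sub-comm z (+ toℕ i) (+ 1))))))) ⟩
    sumFin (λ i → coeffℤ (a ∷ f) (z ℤ.- + toℕ i) * h i) ∎
    where
    open ≡-Reasoning
    H = tabulate h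
    coeffℤ-[0] : ∀ z → coeffℤ (0# ∷ []) z ≡ 0#
    coeffℤ-[0] (+ zero)  = refl
    coeffℤ-[0] (+ suc n) = refl
    coeffℤ-[0] -[1+ n ]  = refl

  module PowerCoefficients {n} (h : Fin n → QF) where
    powerCoeff : ℕ → ℤ → QF
    powerCoeff m = coeffℤ (polyPow D (tabulate h) m)

    toℤ : Fin n → ℤ
    toℤ i = + toℕ i

    powerCoeff-suc : ∀ m z → powerCoeff (suc m) z ≡ sumFin (λ i → powerCoeff m (z ℤ.- toℤ i) * h i)
    powerCoeff-suc m = coeffℤ-polyMul-tabulate (polyPow D (tabulate h) m) h

    convolve : ∀ m (a : Fin n → QF) z →
      sumFin (λ i → h i * sumFin (λ j → a j * powerCoeff m ((z ℤ.- toℤ i) ℤ.- toℤ j))) ≡ sumFin (λ j → a j * powerCoeff (suc m) (z ℤ.- toℤ j))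
    convolve m a z = begin
      sumFin (λ i → h i * sumFin (λ j → a j * powerCoeff m ((z ℤ.- toℤ i) ℤ.- toℤ j)))
        ≡⟨ sumFin-cong (λ i → *-distribˡ-sumFin (h i) _) ⟩
      sumFin (λ i → sumFin (λ j → h i * (a j * powerCoeff m ((z ℤ.- toℤ i) ℤ.- toℤ j))))
        ≡⟨ sumFin-swap _ ⟩
      sumFin (λ j → sumFin (λ i → h i * (a j * powerCoeff m ((z ℤ.- toℤ i) ℤ.- toℤ j))))
        ≡⟨ sumFin-cong (λ j → sumFin-cong (λ i → trans (cong (λ w → h i * (a j * powerCoeff m w)) (sub-sub-comm z (toℤ i) (toℤ j)))
             (solve 3 (λ hᵢ aⱼ g → hᵢ :* (aⱼ :* g) := aⱼ :* (g :* hᵢ)) refl (h i) (a j) (powerCoeff m ((z ℤ.- toℤ j) ℤ.- toℤ i))))) ⟩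
      sumFin (λ j → sumFin (λ i → a j * (powerCoeff m ((z ℤ.- toℤ j) ℤ.- toℤ i) * h i)))
        ≡⟨ sumFin-cong (λ j → trans (sym (*-distribˡ-sumFin (a j) _)) (cong (a j *_) (sym (powerCoeff-suc m (z ℤ.- toℤ j))))) ⟩
      sumFin (λ j → a j * powerCoeff (suc m) (z ℤ.- toℤ j)) ∎
      where open ≡-Reasoning

    -- The coefficient of x^(z − 1) in h · (hᵐ)′ = m · h′ · hᵐ.
    leibniz : ∀ m z → sumFin (λ i → h i * (ι (z ℤ.- toℤ i) * powerCoeff m (z ℤ.- toℤ i)))
                     ≡ ι (+ m) * sumFin (λ i → (ι (toℤ i) * h i) * powerCoeff m (z ℤ.- toℤ i))
    leibniz zero z = trans (sumFin-cong (λ i → trans (cong (h i *_) (ι*powerCoeff₀ (z ℤ.- toℤ i))) (zeroʳ (h i))))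
                           (trans sumFin-zero (sym (zeroˡ (sumFin (λ i → (ι (toℤ i) * h i) * powerCoeff zero (z ℤ.- toℤ i))))))
      where
      ι*powerCoeff₀ : ∀ w → ι w * powerCoeff zero w ≡ 0#
      ι*powerCoeff₀ (+ zero)  = zeroˡ 1#
      ι*powerCoeff₀ (+ suc k) = zeroʳ (ι (+ suc k))
      ι*powerCoeff₀ -[1+ k ]  = zeroʳ (ι -[1+ k ])
    leibniz (suc m) z = begin
      sumFin (λ i → h i * (ι (z ℤ.- toℤ i) * powerCoeff (suc m) (z ℤ.- toℤ i)))
        ≡⟨ sumFin-cong expand ⟩
      sumFin (λ i → sumFin (λ j → A i j + B i j))
        ≡⟨ trans (sumFin-cong (λ i → sumFin-+ (A i) (B i))) (sumFin-+ _ _) ⟩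
      sumFin (λ i → sumFin (A i)) + sumFin (λ i → sumFin (B i))
        ≡⟨ cong₂ _+_ ΣA ΣB ⟩
      ι (+ m) * X (suc m) + X (suc m)
        ≡⟨ solve 2 (λ c x → c :* x :+ x := (con (+ 1) :+ c) :* x) refl (ι (+ m)) (X (suc m)) ⟩
      (ι (+ 1) + ι (+ m)) * X (suc m)
        ≡⟨ cong (_* X (suc m)) (ι-+ D (+ 1) (+ m)) ⟨
      ι (+ suc m) * X (suc m) ∎
      where
      open ≡-Reasoning
      X : ℕ → QF
      X k = sumFin (λ i → (ι (toℤ i) * h i) * powerCoeff k (z ℤ.- toℤ i))
      A B : Fin n → Fin n → QF
      A i j = h j * (h i * (ι ((z ℤ.- toℤ j) ℤ.- toℤ i) * powerCoeff m ((z ℤ.- toℤ j) ℤ.- toℤ i)))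
      B i j = (ι (toℤ j) * h j) * (powerCoeff m ((z ℤ.- toℤ j) ℤ.- toℤ i) * h i)
      expand : ∀ i → h i * (ι (z ℤ.- toℤ i) * powerCoeff (suc m) (z ℤ.- toℤ i)) ≡ sumFin (λ j → A i j + B i j)
      expand i = begin
        h i * (ι (z ℤ.- toℤ i) * powerCoeff (suc m) (z ℤ.- toℤ i))
          ≡⟨ cong (λ g → h i * (ι (z ℤ.- toℤ i) * g)) (powerCoeff-suc m (z ℤ.- toℤ i)) ⟩
        h i * (ι (z ℤ.- toℤ i) * sumFin (λ j → powerCoeff m ((z ℤ.- toℤ i) ℤ.- toℤ j) * h j))
          ≡⟨ trans (cong (h i *_) (*-distribˡ-sumFin (ι (z ℤ.- toℤ i)) (λ j → powerCoeff m ((z ℤ.- toℤ i) ℤ.- toℤ j) * h j)))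
                   (*-distribˡ-sumFin (h i) (λ j → ι (z ℤ.- toℤ i) * (powerCoeff m ((z ℤ.- toℤ i) ℤ.- toℤ j) * h j))) ⟩
        sumFin (λ j → h i * (ι (z ℤ.- toℤ i) * (powerCoeff m ((z ℤ.- toℤ i) ℤ.- toℤ j) * h j)))
          ≡⟨ sumFin-cong (λ j → trans (cong₂ (λ c g → h i * (c * (g * h j))) (split i j) (cong (powerCoeff m) (sub-sub-comm z (toℤ i) (toℤ j))))
               (solve 5 (λ hᵢ hⱼ c ιⱼ g → hᵢ :* ((c :+ ιⱼ) :* (g :* hⱼ)) := hⱼ :* (hᵢ :* (c :* g)) :+ (ιⱼ :* hⱼ) :* (g :* hᵢ))
                 refl (h i) (h j) (ι ((z ℤ.- toℤ j) ℤ.- toℤ i)) (ι (toℤ j)) (powerCoeff m ((z ℤ.- toℤ j) ℤ.- toℤ i)))) ⟩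
        sumFin (λ j → A i j + B i j) ∎
        where
        split : ∀ i j → ι (z ℤ.- toℤ i) ≡ ι ((z ℤ.- toℤ j) ℤ.- toℤ i) + ι (toℤ j)
        split i j = trans (cong ι (sub-split z (toℤ i) (toℤ j)))
                          (ι-+ D ((z ℤ.- toℤ j) ℤ.- toℤ i) (toℤ j))
      ΣA : sumFin (λ i → sumFin (A i)) ≡ ι (+ m) * X (suc m)
      ΣA = begin
        sumFin (λ i → sumFin (A i))
          ≡⟨ sumFin-swap A ⟩
        sumFin (λ j → sumFin (λ i → A i j))
          ≡⟨ sumFin-cong (λ j → sym (*-distribˡ-sumFin (h j) _)) ⟩
        sumFin (λ j → h j * sumFin (λ i → h i * (ι ((z ℤ.- toℤ j) ℤ.- toℤ i) * powerCoeff m ((z ℤ.- toℤ j) ℤ.- toℤ i))))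
          ≡⟨ sumFin-cong (λ j → cong (h j *_) (leibniz m (z ℤ.- toℤ j))) ⟩
        sumFin (λ j → h j * (ι (+ m) * sumFin (λ i → (ι (toℤ i) * h i) * powerCoeff m ((z ℤ.- toℤ j) ℤ.- toℤ i))))
          ≡⟨ sumFin-cong (λ j → solve 3 (λ hⱼ c x → hⱼ :* (c :* x) := c :* (hⱼ :* x)) refl (h j) (ι (+ m)) _) ⟩
        sumFin (λ j → ι (+ m) * (h j * sumFin (λ i → (ι (toℤ i) * h i) * powerCoeff m ((z ℤ.- toℤ j) ℤ.- toℤ i))))
          ≡⟨ *-distribˡ-sumFin (ι (+ m)) _ ⟨
        ι (+ m) * sumFin (λ j → h j * sumFin (λ i → (ι (toℤ i) * h i) * powerCoeff m ((z ℤ.- toℤ j) ℤ.- toℤ i)))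
          ≡⟨ cong (ι (+ m) *_) (convolve m (λ i → ι (toℤ i) * h i) z) ⟩
        ι (+ m) * X (suc m) ∎
      ΣB : sumFin (λ i → sumFin (B i)) ≡ X (suc m)
      ΣB = trans (sumFin-swap B) (sumFin-cong (λ j → trans (sym (*-distribˡ-sumFin (ι (toℤ j) * h j) _))
             (cong (ι (toℤ j) * h j *_) (sym (powerCoeff-suc m (z ℤ.- toℤ j))))))

  module _ {n} (h : Fin (suc n) → QF) where
    open PowerCoefficients h

    powerCoeff-zero : ∀ m → powerCoeff m (+ 0) ≡ powK D (h zero) m
    powerCoeff-zero zero    = refl
    powerCoeff-zero (suc m) = begin
      powerCoeff (suc m) (+ 0)
        ≡⟨ powerCoeff-suc m (+ 0) ⟩
      powerCoeff m (+ 0) * h zero + sumFin (λ i → 0# * h (suc i))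
        ≡⟨ cong (_+_ (powerCoeff m (+ 0) * h zero)) (trans (sumFin-cong (λ i → zeroˡ (h (suc i)))) sumFin-zero) ⟩
      powerCoeff m (+ 0) * h zero + 0#
        ≡⟨ trans (+-identityʳ _) (cong (_* h zero) (powerCoeff-zero m)) ⟩
      powK D (h zero) (suc m) ∎
      where open ≡-Reasoning

    -- For p = 2n′ + 1 this says 2z h₀ f_z ≡ Σ_{i ≥ 1} (i − 2z) hᵢ f_{z − i} (mod p), f = h^{n′}.
    recurrence : ∀ n′ z →
      sumFin (λ i → (ι (toℤ (suc i)) - ι (z ℤ.+ z)) * h (suc i) * powerCoeff n′ (z ℤ.- toℤ (suc i)))
        + ι (+ suc (n′ ℕ.+ n′)) * sumFin (λ i → (ι (toℤ i) * h i) * powerCoeff n′ (z ℤ.- toℤ i))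
      ≡ ι (z ℤ.+ z) * h zero * powerCoeff n′ z
    recurrence n′ z = begin
      Σ′ + ι (+ suc (n′ ℕ.+ n′)) * X
        ≡⟨ cong (λ t → Σ′ + t * X) (trans (ι-+ D (+ 1) (+ (n′ ℕ.+ n′))) (cong (_+_ 1#) (ι-+ D (+ n′) (+ n′)))) ⟩
      Σ′ + (1# + (m + m)) * X
        ≡⟨ solve 6 (λ Σ′ X c m h₀ g → Σ′ :+ (con (+ 1) :+ (m :+ m)) :* X
                      := ((con (+ 0) :- (c :+ c)) :* h₀ :* g :+ Σ′) :+ (c :+ c) :* h₀ :* g :+ (con (+ 1) :+ (m :+ m)) :* X)
             refl Σ′ X c m (h zero) (powerCoeff n′ z) ⟩
      ((0# - (c + c)) * h zero * powerCoeff n′ z + Σ′) + (c + c) * h zero * powerCoeff n′ z + (1# + (m + m)) * X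
        ≡⟨ cong (λ t → t + (c + c) * h zero * powerCoeff n′ z + (1# + (m + m)) * X) all-terms ⟩
      (- (c + c) * S + 1# * X) + (c + c) * h zero * powerCoeff n′ z + (1# + (m + m)) * X
        ≡⟨ solve 6 (λ X S c m h₀ g → (:- (c :+ c) :* S :+ con (+ 1) :* X) :+ (c :+ c) :* h₀ :* g :+ (con (+ 1) :+ (m :+ m)) :* X
                      := (c :+ c) :* h₀ :* g :+ (m :* X :+ m :* X) :- ((c :* S :+ :- con (+ 1) :* X) :+ (c :* S :+ :- con (+ 1) :* X)))
             refl X S c m (h zero) (powerCoeff n′ z) ⟩
      (c + c) * h zero * powerCoeff n′ z + (m * X + m * X) - ((c * S + - 1# * X) + (c * S + - 1# * X))
        ≡⟨ cong (λ t → (c + c) * h zero * powerCoeff n′ z + (m * X + m * X) - (t + t)) leibniz′ ⟩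
      (c + c) * h zero * powerCoeff n′ z + (m * X + m * X) - (m * X + m * X)
        ≡⟨ solve 2 (λ a b → a :+ b :- b := a) refl ((c + c) * h zero * powerCoeff n′ z) (m * X + m * X) ⟩
      (c + c) * h zero * powerCoeff n′ z
        ≡⟨ cong (λ t → t * h zero * powerCoeff n′ z) (ι-+ D z z) ⟨
      ι (z ℤ.+ z) * h zero * powerCoeff n′ z ∎
      where
      open ≡-Reasoning
      c m S X Σ′ : QF
      c = ι z
      m = ι (+ n′)
      S = sumFin (λ i → h i * powerCoeff n′ (z ℤ.- toℤ i))
      X = sumFin (λ i → (ι (toℤ i) * h i) * powerCoeff n′ (z ℤ.- toℤ i))
      Σ′ = sumFin (λ i → (ι (toℤ (suc i)) - ι (z ℤ.+ z)) * h (suc i) * powerCoeff n′ (z ℤ.- toℤ (suc i)))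
      all-terms : (0# - (c + c)) * h zero * powerCoeff n′ z + Σ′ ≡ - (c + c) * S + 1# * X
      all-terms = begin
        (0# - (c + c)) * h zero * powerCoeff n′ z + Σ′
          ≡⟨ cong₂ (λ t w → (0# - t) * h zero * powerCoeff n′ w + Σ′) (ι-+ D z z) (ℤP.+-identityʳ z) ⟨
        sumFin (λ i → (ι (toℤ i) - ι (z ℤ.+ z)) * h i * powerCoeff n′ (z ℤ.- toℤ i))
          ≡⟨ sumFin-cong (λ i → trans (cong (λ t → (ι (toℤ i) - t) * h i * powerCoeff n′ (z ℤ.- toℤ i)) (ι-+ D z z))
               (solve 4 (λ ιᵢ c hᵢ g → (ιᵢ :- (c :+ c)) :* hᵢ :* g := :- (c :+ c) :* (hᵢ :* g) :+ con (+ 1) :* ((ιᵢ :* hᵢ) :* g))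
                 refl (ι (toℤ i)) c (h i) (powerCoeff n′ (z ℤ.- toℤ i)))) ⟩
        sumFin (λ i → - (c + c) * (h i * powerCoeff n′ (z ℤ.- toℤ i)) + 1# * ((ι (toℤ i) * h i) * powerCoeff n′ (z ℤ.- toℤ i)))
          ≡⟨ sumFin-linear (- (c + c)) 1# (λ i → h i * powerCoeff n′ (z ℤ.- toℤ i)) (λ i → (ι (toℤ i) * h i) * powerCoeff n′ (z ℤ.- toℤ i)) ⟩
        - (c + c) * S + 1# * X ∎
      leibniz′ : c * S + - 1# * X ≡ m * X
      leibniz′ = begin
        c * S + - 1# * X
          ≡⟨ sumFin-linear c (- 1#) (λ i → h i * powerCoeff n′ (z ℤ.- toℤ i)) (λ i → (ι (toℤ i) * h i) * powerCoeff n′ (z ℤ.- toℤ i)) ⟨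
        sumFin (λ i → c * (h i * powerCoeff n′ (z ℤ.- toℤ i)) + - 1# * ((ι (toℤ i) * h i) * powerCoeff n′ (z ℤ.- toℤ i)))
          ≡⟨ sumFin-cong (λ i → trans (solve 4 (λ c ιᵢ hᵢ g → c :* (hᵢ :* g) :+ :- con (+ 1) :* ((ιᵢ :* hᵢ) :* g) := hᵢ :* ((c :+ :- ιᵢ) :* g))
                 refl c (ι (toℤ i)) (h i) (powerCoeff n′ (z ℤ.- toℤ i)))
               (sym (cong (λ t → h i * (t * powerCoeff n′ (z ℤ.- toℤ i))) (trans (ι-+ D z (ℤ.- toℤ i)) (cong (_+_ c) (ι-neg D (toℤ i))))))) ⟩
        sumFin (λ i → h i * (ι (z ℤ.- toℤ i) * powerCoeff n′ (z ℤ.- toℤ i)))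
          ≡⟨ leibniz n′ z ⟩
        m * X ∎

-- Congruence modulo p O_K

module _ (D : ℤ) where
  open CommutativeRing (quadraticRing D) using (_+_; _*_; -_; _-_; 0#; 1#)

  integral-0# : Integral D 0#
  integral-0# = integral-ι D (+ 0)

  integral-1# : Integral D 1#
  integral-1# = integral-ι D (+ 1)

  integral-sumFin : ∀ {n} (f : Fin n → QF) → (∀ i → Integral D (f i)) → Integral D (sumFin f)
  integral-sumFin {zero}  f f∈O = integral-0#
  integral-sumFin {suc n} f f∈O = integral-+ D (f∈O zero) (integral-sumFin (f ∘ suc) (f∈O ∘ suc))

  integral-powK : ∀ {x} → Integral D x → ∀ m → Integral D (powK D x m)
  integral-powK x∈O zero    = integral-1#
  integral-powK x∈O (suc m) = integral-* D (integral-powK x∈O m) x∈O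

  integral-if : ∀ b {x y} → Integral D x → Integral D y → Integral D (if b then x else y)
  integral-if true  x∈O _   = x∈O
  integral-if false _   y∈O = y∈O

  integral-coefN : ∀ {n} (h : Fin n → QF) → (∀ i → Integral D (h i)) → ∀ m → Integral D (coefN h m)
  integral-coefN {zero}  h h∈O m       = integral-0#
  integral-coefN {suc n} h h∈O zero    = h∈O zero
  integral-coefN {suc n} h h∈O (suc m) = integral-coefN (h ∘ suc) (h∈O ∘ suc) m

  module _ {n} (h : Fin n → QF) (h∈O : ∀ i → Integral D (h i)) where
    open PowerCoefficients D h

    integral-powerCoeff : ∀ m z → Integral D (powerCoeff m z)
    integral-powerCoeff zero    (+ zero)  = integral-1#
    integral-powerCoeff zero    (+ suc k) = integral-0#
    integral-powerCoeff zero    -[1+ k ]  = integral-0#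
    integral-powerCoeff (suc m) z = subst (Integral D) (sym (powerCoeff-suc m z))
      (integral-sumFin _ (λ i → integral-* D (integral-powerCoeff m (z ℤ.- toℤ i)) (h∈O i)))

module ModuloP (D : ℤ) (p : ℕ) where
  open Congruence.Modulo (quadraticRing D) (Integral D) (integral-0# D) (integral-+ D) (integral-neg D) (integral-* D) (ι (+ p)) public
  open CommutativeRing (quadraticRing D) using (_+_; _*_; -_; _-_; 0#; 1#)

  ≋⇒CongMod : ∀ {x y} → x ≋ y → CongMod D p x y
  ≋⇒CongMod (multiple (integral z∈O) x-y≡pz) = _ , z∈O , x-y≡pz

  CongMod⇒≋ : ∀ {x y} → CongMod D p x y → x ≋ y
  CongMod⇒≋ (_ , z∈O , x-y≡pz) = multiple (integral z∈O) x-y≡pz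

  sumFin-≋ : ∀ {n} {f g : Fin n → QF} → (∀ i → f i ≋ g i) → sumFin f ≋ sumFin g
  sumFin-≋ {zero}  f≋g = ≈⇒≋ refl
  sumFin-≋ {suc n} f≋g = +-cong≋ (f≋g zero) (sumFin-≋ (f≋g ∘ suc))

  powK-≋ : ∀ {x y} → Integral D x → Integral D y → x ≋ y → ∀ m → powK D x m ≋ powK D y m
  powK-≋ x∈O y∈O x≋y zero    = ≈⇒≋ refl
  powK-≋ x∈O y∈O x≋y (suc m) = ≋-trans (*-congʳ≋ x∈O (powK-≋ x∈O y∈O x≋y m)) (*-congˡ≋ (integral-powK D y∈O m) x≋y)

  ι-≋ : ∀ {a b} → IntegersModulo._≋_ p a b → ι a ≋ ι b
  ι-≋ {a} {b} (IntegersModulo.multiple {quotient = c} _ a-b≡pc) = multiple (integral-ι D c) (begin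
    ι a - ι b          ≡⟨ cong (_+_ (ι a)) (ι-neg D b) ⟨
    ι a + ι (ℤ.- b)    ≡⟨ ι-+ D a (ℤ.- b) ⟨
    ι (a ℤ.- b)        ≡⟨ cong ι a-b≡pc ⟩
    ι (+ p ℤ.* c)      ≡⟨ ι-* D (+ p) c ⟩
    ι (+ p) * ι c      ∎)
    where open ≡-Reasoning

-- The matrices M_k

module _ (D : ℤ) where
  open CommutativeRing (quadraticRing D) using (_+_; _*_; 0#; 1#; +-identityˡ; +-identityʳ; +-comm; +-assoc; *-identityʳ; zeroʳ; zeroˡ; *-assoc; *-comm)

  sumFin-indicator : ∀ {n} (g : Fin n → QF) (j : Fin n) c →
    sumFin (λ l → g l * (if does (toℕ l ℕ.≟ toℕ j) then c else 0#)) ≡ g j * c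
  sumFin-indicator g zero c = trans (cong (_+_ (g zero * c)) (trans (sumFin-cong D (λ l → zeroʳ (g (suc l)))) (sumFin-zero D)))
    (+-identityʳ (g zero * c))
  sumFin-indicator g (suc j) c = trans (cong (_+ rest) (zeroʳ (g zero)))
    (trans (+-identityˡ rest) (sumFin-indicator (g ∘ suc) j c))
    where rest = sumFin (λ l → g (suc l) * (if does (toℕ l ℕ.≟ toℕ j) then c else 0#))

  sumFin-last : ∀ {n} (f : Fin (suc n) → QF) → sumFin f ≡ sumFin (f ∘ inject₁) + f (fromℕ n)
  sumFin-last {zero}  f = +-comm (f zero) 0#
  sumFin-last {suc n} f = trans (cong (_+_ (f zero)) (sumFin-last (f ∘ suc)))
    (sym (+-assoc (f zero) (sumFin (f ∘ suc ∘ inject₁)) (f (fromℕ (suc n)))))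

  sumFin-opposite : ∀ {n} (f : Fin n → QF) → sumFin (f ∘ opposite) ≡ sumFin f
  sumFin-opposite {zero}  f = refl
  sumFin-opposite {suc n} f = trans (cong (_+_ (f (fromℕ n))) (sumFin-opposite (f ∘ inject₁)))
    (trans (+-comm (f (fromℕ n)) (sumFin (f ∘ inject₁))) (sym (sumFin-last f)))

  vecMat-idMat : ∀ v j → vecMat D v idMat j ≡ v j
  vecMat-idMat v j = trans (sumFin-indicator v j 1#) (*-identityʳ (v j))

  vecMat-matMul : ∀ v A B j → vecMat D v (matMul D A B) j ≡ vecMat D (vecMat D v A) B j
  vecMat-matMul v A B j = begin
    sumFin (λ l → v l * sumFin (λ m → A l m * B m j))    ≡⟨ sumFin-cong D (λ l → *-distribˡ-sumFin D (v l) (λ m → A l m * B m j)) ⟩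
    sumFin (λ l → sumFin (λ m → v l * (A l m * B m j)))  ≡⟨ sumFin-swap D (λ l m → v l * (A l m * B m j)) ⟩
    sumFin (λ m → sumFin (λ l → v l * (A l m * B m j)))  ≡⟨ sumFin-cong D (λ m → sumFin-cong D (λ l → sym (*-assoc (v l) (A l m) (B m j)))) ⟩
    sumFin (λ m → sumFin (λ l → v l * A l m * B m j))    ≡⟨ sumFin-cong D (λ m → sumFin-*ʳ (B m j) (λ l → v l * A l m)) ⟩
    sumFin (λ m → sumFin (λ l → v l * A l m) * B m j)    ∎
    where
    open ≡-Reasoning
    sumFin-*ʳ : ∀ {n} c (f : Fin n → QF) → sumFin (λ i → f i * c) ≡ sumFin f * c
    sumFin-*ʳ c f = trans (sumFin-cong D (λ i → *-comm (f i) c)) (trans (sym (*-distribˡ-sumFin D c f)) (*-comm c (sumFin f)))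

  M-inject₁ : ∀ (h : Fin 9 → QF) k l (j : Fin 7) →
    M D h k l (inject₁ j) ≡ (if does (toℕ l ℕ.≟ toℕ (suc j)) then ι (+ (2 ℕ.* k)) * h zero else 0#)
  M-inject₁ h k l j rewrite dec-false (toℕ (inject₁ j) ℕ.≟ 7) (toℕ-inject₁-≢ j ∘ sym) | toℕ-inject₁ j = refl

  vecMat-M-inject₁ : ∀ (h : Fin 9 → QF) w k (j : Fin 7) → vecMat D w (M D h k) (inject₁ j) ≡ w (suc j) * (ι (+ (2 ℕ.* k)) * h zero)
  vecMat-M-inject₁ h w k j = trans (sumFin-cong D (λ l → cong (w l *_) (M-inject₁ h k l j))) (sumFin-indicator w (suc j) _)

∀-snoc : ∀ {n} {P : Fin (suc n) → Set} → (∀ i → P (inject₁ i)) → P (fromℕ n) → ∀ i → P i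
∀-snoc {P = P} P-inject₁ P-last i with view i
... | ‵fromℕ     = P-last
... | ‵inject₁ j = P-inject₁ j

module _ (D : ℤ) where
  open CommutativeRing (quadraticRing D) using (_+_; _*_)
  open K-Solver D using (solve; _:*_; _:=_)

  coefN-toℕ : ∀ {n} (g : Fin n → QF) i → coefN g (toℕ i) ≡ g i
  coefN-toℕ g zero    = refl
  coefN-toℕ g (suc i) = coefN-toℕ (g ∘ suc) i

  module _ (h : Fin 9 → QF) where
    open PowerCoefficients D h
    open CommutativeRing (quadraticRing D) using (-_; _-_)

    private
      9-[8-i] : ∀ {t} → t ≤ 7 → 9 ℕ.∸ suc (7 ℕ.∸ t) ≡ suc t
      9-[8-i] {t} t≤7 = trans (ℕP.+-∸-assoc 1 (ℕP.m∸n≤m 7 t)) (cong suc (ℕP.m∸[m∸n]≡n t≤7))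

      ι-[i-2k] : ∀ k t → ι (+ suc t ℤ.- + (2 ℕ.* suc k)) ≡ ι (+ suc t) - ι (+ suc k ℤ.+ + suc k)
      ι-[i-2k] k t = trans (cong (λ w → ι (+ suc t ℤ.- + w)) (cong (suc k ℕ.+_) (ℕP.+-identityʳ (suc k))))
        (trans (ι-+ D (+ suc t) (ℤ.- + (suc k ℕ.+ suc k))) (cong (_+_ (ι (+ suc t))) (ι-neg D (+ (suc k ℕ.+ suc k)))))

    column-entry : ∀ m k (i : Fin 8) →
      powerCoeff m (+ k ℤ.+ + toℕ (opposite i) ℤ.- + 7) * M D h (suc k) (opposite i) (fromℕ 7)
        ≡ (ι (toℤ (suc i)) - ι (+ suc k ℤ.+ + suc k)) * h (suc i) * powerCoeff m (+ suc k ℤ.- toℤ (suc i))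
    column-entry m k i rewrite opposite-prop i | 9-[8-i] (ℕP.≤-pred (toℕ<n i)) = begin
      powerCoeff m (+ k ℤ.+ + (7 ℕ.∸ t) ℤ.- + 7) * (ι (+ suc t ℤ.- + (2 ℕ.* suc k)) * coefN (h ∘ suc) t)
        ≡⟨ cong₂ (λ g c → g * (c * coefN (h ∘ suc) t)) (cong (powerCoeff m) (index-column k (ℕP.≤-pred (toℕ<n i)))) (ι-[i-2k] k t) ⟩
      powerCoeff m (+ suc k ℤ.- + suc t) * (c * coefN (h ∘ suc) t)
        ≡⟨ cong (λ hᵢ → powerCoeff m (+ suc k ℤ.- + suc t) * (c * hᵢ)) (coefN-toℕ (h ∘ suc) i) ⟩
      powerCoeff m (+ suc k ℤ.- + suc t) * (c * h (suc i))
        ≡⟨ solve 3 (λ g c hᵢ → g :* (c :* hᵢ) := c :* hᵢ :* g) refl (powerCoeff m (+ suc k ℤ.- + suc t)) c (h (suc i)) ⟩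
      c * h (suc i) * powerCoeff m (+ suc k ℤ.- + suc t) ∎
      where
      open ≡-Reasoning
      t : ℕ
      t = toℕ i
      c : QF
      c = ι (+ suc t) - ι (+ suc k ℤ.+ + suc k)

-- The invariant of V₀ M₁ ⋯ M_k

module Invariant (D : ℤ) (h : Fin 9 → QF) (h∈O : ∀ i → Integral D (h i)) (p n : ℕ) (p≡1+2n : p ≡ suc (n ℕ.+ n))
                 (u : QF) (u∈O : Integral D u) (h₀u≋1 : ModuloP._≋_ D p (mulK D (h zero) u) 1K) where
  open ModuloP D p
  open PowerCoefficients D h
  open CommutativeRing (quadraticRing D) using (_+_; _*_; -_; _-_; 0#; 1#; +-identityʳ; *-identityˡ; *-identityʳ; zeroʳ; *-assoc)
  open K-Solver D using (solve; _:+_; _:*_; _:=_; :-_; con)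
  open SetoidReasoning ≋-setoid

  U : QF
  U = powK D u n

  scale : ℕ → QF
  scale k = U * (ι (+ evens k) * powK D (h zero) k)

  v : ℕ → Vec8
  v k = vecMat D V0 (prodM D h k)

  integral-scale : ∀ k → Integral D (scale k)
  integral-scale k = integral-* D (integral-powK D u∈O n) (integral-* D (integral-ι D (+ evens k)) (integral-powK D (h∈O zero) k))

  integral-M : ∀ k i j → Integral D (M D h k i j)
  integral-M k i j = integral-if D (does (toℕ j ℕ.≟ 7))
    (integral-* D (integral-ι D (+ (9 ℕ.∸ suc (toℕ i)) ℤ.- + (2 ℕ.* k))) (integral-coefN D h h∈O (9 ℕ.∸ suc (toℕ i))))
    (integral-if D (does (toℕ i ℕ.≟ suc (toℕ j))) (integral-* D (integral-ι D (+ (2 ℕ.* k))) (h∈O zero)) (integral-0# D))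

  scale-suc : ∀ k → scale (suc k) ≡ scale k * (ι (+ (2 ℕ.* suc k)) * h zero)
  scale-suc k = trans (cong (λ e → U * (e * (powK D (h zero) k * h zero))) (trans (cong ι (ℤP.pos-* (evens k) _)) (ι-* D (+ evens k) _)))
    (solve 5 (λ U e x c h₀ → U :* ((e :* c) :* (x :* h₀)) := U :* (e :* x) :* (c :* h₀)) refl U (ι (+ evens k)) (powK D (h zero) k) (ι (+ (2 ℕ.* suc k))) (h zero))

  U*h₀ⁿ≋1 : U * powK D (h zero) n ≋ 1#
  U*h₀ⁿ≋1 = ≋-trans (≈⇒≋ (trans (*-comm U _) (sym (powK-* D (h zero) u n))))
    (≋-trans (powK-≋ (integral-* D (h∈O zero) u∈O) (integral-1# D) h₀u≋1 n) (≈⇒≋ (powK-1# D n)))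
    where open CommutativeRing (quadraticRing D) using (*-comm)

  last-column : ∀ k → sumFin (λ l → powerCoeff n (+ k ℤ.+ + toℕ l ℤ.- + 7) * M D h (suc k) l (fromℕ 7))
                      ≋ ι (+ (2 ℕ.* suc k)) * h zero * powerCoeff n (+ suc k)
  last-column k = begin
    sumFin (λ l → powerCoeff n (+ k ℤ.+ + toℕ l ℤ.- + 7) * M D h (suc k) l (fromℕ 7))
      ≡⟨ sumFin-opposite D (λ l → powerCoeff n (+ k ℤ.+ + toℕ l ℤ.- + 7) * M D h (suc k) l (fromℕ 7)) ⟨
    sumFin (λ i → powerCoeff n (+ k ℤ.+ + toℕ (opposite i) ℤ.- + 7) * M D h (suc k) (opposite i) (fromℕ 7))
      ≡⟨ trans (sumFin-cong D (column-entry D h n k)) (sym (+-identityʳ Σ′)) ⟩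
    Σ′ + 0#
      ≈⟨ +-cong≋ (≈⇒≋ {Σ′} refl) (≋-sym p*X≋0) ⟩
    Σ′ + ι (+ suc (n ℕ.+ n)) * X
      ≡⟨ recurrence D h n z ⟩
    ι (z ℤ.+ z) * h zero * powerCoeff n z
      ≡⟨ cong (λ w → ι (+ w) * h zero * powerCoeff n z) (cong (suc k ℕ.+_) (sym (ℕP.+-identityʳ (suc k)))) ⟩
    ι (+ (2 ℕ.* suc k)) * h zero * powerCoeff n (+ suc k) ∎
    where
    z : ℤ
    z = + suc k
    Σ′ X : QF
    Σ′ = sumFin (λ i → (ι (toℤ (suc i)) - ι (z ℤ.+ z)) * h (suc i) * powerCoeff n (z ℤ.- toℤ (suc i)))
    X = sumFin (λ i → (ι (toℤ i) * h i) * powerCoeff n (z ℤ.- toℤ i))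
    p*X≋0 : ι (+ suc (n ℕ.+ n)) * X ≋ 0#
    p*X≋0 = subst (λ q → ι (+ q) * X ≋ 0#) p≡1+2n
      (π*x≋0 (integral-sumFin D _ (λ i → integral-* D (integral-* D (integral-ι D (toℤ i)) (h∈O i)) (integral-powerCoeff D h h∈O n (z ℤ.- toℤ i)))))

  powerCoeff-below : ∀ m {t} → t < 7 → powerCoeff m (+ t ℤ.- + 7) ≡ 0#
  powerCoeff-below m t<7 = cong (powerCoeff m) (index-below t<7)

  V0-inject₁ : ∀ j → V0 (inject₁ j) ≡ 0#
  V0-inject₁ j = cong (λ b → if b then 1K else 0K) (dec-false (toℕ (inject₁ j) ℕ.≟ 7) (toℕ-inject₁-≢ j ∘ sym))

  window : ℕ → Fin 8 → QF
  window k j = scale k * powerCoeff n (+ k ℤ.+ + toℕ j ℤ.- + 7)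

  invariant-base : ∀ j → v 0 j ≋ window 0 j
  invariant-base = ∀-snoc
    (λ j → begin
      v 0 (inject₁ j)                                 ≡⟨ trans (vecMat-idMat D V0 (inject₁ j)) (V0-inject₁ j) ⟩
      0#                                              ≡⟨ zeroʳ (scale 0) ⟨
      scale 0 * 0#                                    ≡⟨ cong (scale 0 *_) (powerCoeff-below n (toℕ<n j)) ⟨
      scale 0 * powerCoeff n (+ toℕ j ℤ.- + 7)        ≡⟨ cong (λ t → scale 0 * powerCoeff n (+ t ℤ.- + 7)) (toℕ-inject₁ j) ⟨
      window 0 (inject₁ j)                            ∎)
    (begin
      v 0 (fromℕ 7)                                   ≡⟨ vecMat-idMat D V0 (fromℕ 7) ⟩
      1#                                              ≈⟨ U*h₀ⁿ≋1 ⟨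
      U * powK D (h zero) n                           ≡⟨ solve 2 (λ U x → U :* x := U :* (con (+ 1) :* con (+ 1)) :* x) refl U (powK D (h zero) n) ⟩
      scale 0 * powK D (h zero) n                     ≡⟨ cong (scale 0 *_) (powerCoeff-zero D h n) ⟨
      window 0 (fromℕ 7)                              ∎)

  invariant-shift : ∀ k j → v k (suc j) ≋ window k (suc j) → v (suc k) (inject₁ j) ≋ window (suc k) (inject₁ j)
  invariant-shift k j v≋window = begin
    v (suc k) (inject₁ j)
      ≡⟨ trans (vecMat-matMul D V0 (prodM D h k) (M D h (suc k)) (inject₁ j)) (vecMat-M-inject₁ D h (v k) (suc k) j) ⟩
    v k (suc j) * c
      ≈⟨ *-congʳ≋ (integral-* D (integral-ι D (+ (2 ℕ.* suc k))) (h∈O zero)) v≋window ⟩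
    scale k * powerCoeff n (+ k ℤ.+ + suc (toℕ j) ℤ.- + 7) * c
      ≡⟨ solve 3 (λ s g c → s :* g :* c := s :* c :* g) refl (scale k) (powerCoeff n (+ k ℤ.+ + suc (toℕ j) ℤ.- + 7)) c ⟩
    scale k * c * powerCoeff n (+ k ℤ.+ + suc (toℕ j) ℤ.- + 7)
      ≡⟨ cong₂ _*_ (sym (scale-suc k)) (cong (powerCoeff n) (trans (index-shift k (toℕ j)) (cong (λ t → + suc k ℤ.+ + t ℤ.- + 7) (sym (toℕ-inject₁ j))))) ⟩
    window (suc k) (inject₁ j) ∎
    where
    c = ι (+ (2 ℕ.* suc k)) * h zero

  invariant-last : ∀ k → (∀ j → v k j ≋ window k j) → v (suc k) (fromℕ 7) ≋ window (suc k) (fromℕ 7)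
  invariant-last k v≋window = begin
    v (suc k) (fromℕ 7)
      ≡⟨ vecMat-matMul D V0 (prodM D h k) (M D h (suc k)) (fromℕ 7) ⟩
    sumFin (λ l → v k l * M D h (suc k) l (fromℕ 7))
      ≈⟨ sumFin-≋ (λ l → *-congʳ≋ (integral-M (suc k) l (fromℕ 7)) (v≋window l)) ⟩
    sumFin (λ l → window k l * M D h (suc k) l (fromℕ 7))
      ≡⟨ trans (sumFin-cong D (λ l → *-assoc (scale k) (f l) (M D h (suc k) l (fromℕ 7))))
               (sym (*-distribˡ-sumFin D (scale k) (λ l → f l * M D h (suc k) l (fromℕ 7)))) ⟩
    scale k * sumFin (λ l → f l * M D h (suc k) l (fromℕ 7))
      ≈⟨ *-congˡ≋ (integral-scale k) (last-column k) ⟩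
    scale k * (ι (+ (2 ℕ.* suc k)) * h zero * powerCoeff n (+ suc k))
      ≡⟨ solve 4 (λ s c h₀ g → s :* (c :* h₀ :* g) := s :* (c :* h₀) :* g) refl (scale k) (ι (+ (2 ℕ.* suc k))) (h zero) (powerCoeff n (+ suc k)) ⟩
    scale k * (ι (+ (2 ℕ.* suc k)) * h zero) * powerCoeff n (+ suc k)
      ≡⟨ cong₂ _*_ (sym (scale-suc k)) (cong (powerCoeff n) (sym (index-last (suc k)))) ⟩
    window (suc k) (fromℕ 7) ∎
    where
    f : Fin 8 → QF
    f l = powerCoeff n (+ k ℤ.+ + toℕ l ℤ.- + 7)

  invariant : ∀ k j → v k j ≋ window k j
  invariant zero    = invariant-base
  invariant (suc k) = ∀-snoc (λ j → invariant-shift k j (invariant k (suc j))) (invariant-last k (invariant k))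

  module _ (p-prime : Prime p) where

    evens[2n]≋-1 : ι (+ evens (n ℕ.+ n)) ≋ - ι (+ 1)
    evens[2n]≋-1 = ≋-trans (ι-≋ {+ evens (n ℕ.+ n)} {ℤ.- + 1} (subst (λ q → IntegersModulo._≋_ q (+ evens (n ℕ.+ n)) (ℤ.- + 1)) (sym p≡1+2n)
      (evens≋-1 {n} (subst Prime p≡1+2n p-prime)))) (≈⇒≋ (ι-neg D (+ 1)))

    -U*scale[2n]≋1 : - U * scale (n ℕ.+ n) ≋ 1#
    -U*scale[2n]≋1 = begin
      - U * scale (n ℕ.+ n)
        ≡⟨ cong (λ x → - U * (U * (e * x))) (powK-+ D (h zero) n n) ⟩
      - U * (U * (e * (h₀ⁿ * h₀ⁿ)))
        ≡⟨ solve 3 (λ U e x → :- U :* (U :* (e :* (x :* x))) := :- e :* ((U :* x) :* (U :* x))) refl U e h₀ⁿ ⟩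
      - e * ((U * h₀ⁿ) * (U * h₀ⁿ))
        ≈⟨ *-cong≋ (integral-neg D (integral-neg D (integral-1# D))) (integral-* D Uh₀ⁿ∈O Uh₀ⁿ∈O)
                   (-‿cong≋ evens[2n]≋-1) (*-cong≋ (integral-1# D) Uh₀ⁿ∈O U*h₀ⁿ≋1 U*h₀ⁿ≋1) ⟩
      - - ι (+ 1) * (1# * 1#)
        ≡⟨ solve 0 (:- (:- con (+ 1)) :* (con (+ 1) :* con (+ 1)) := con (+ 1)) refl ⟩
      1# ∎
      where
      e h₀ⁿ : QF
      e = ι (+ evens (n ℕ.+ n))
      h₀ⁿ = powK D (h zero) n
      Uh₀ⁿ∈O : Integral D (U * h₀ⁿ)
      Uh₀ⁿ∈O = integral-* D (integral-powK D u∈O n) (integral-powK D (h∈O zero) n)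

    -U*v[2n]≋powerCoeff : ∀ j → - U * v (n ℕ.+ n) j ≋ powerCoeff n (+ (n ℕ.+ n) ℤ.+ + toℕ j ℤ.- + 7)
    -U*v[2n]≋powerCoeff j = ≋-trans (*-congˡ≋ (integral-neg D (integral-powK D u∈O n)) (invariant (n ℕ.+ n) j))
      (≋-trans (≈⇒≋ (sym (*-assoc (- U) (scale (n ℕ.+ n)) (powerCoeff n z))))
        (≋-trans (*-congʳ≋ (integral-powerCoeff D h h∈O n z) -U*scale[2n]≋1) (≈⇒≋ (*-identityˡ (powerCoeff n z)))))
      where
      z : ℤ
      z = + (n ℕ.+ n) ℤ.+ + toℕ j ℤ.- + 7

    last-coefficients : ∀ d (j : Fin 8) → toℕ j ℕ.+ d ≡ 7 → d ≤ 2 → - U * v (p ℕ.∸ 1) j ≋ powerCoeff n (+ (p ℕ.∸ suc d))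
    last-coefficients d j j+d≡7 d≤2 = subst (λ q → - U * v q j ≋ powerCoeff n (+ (p ℕ.∸ suc d))) (cong ℕ.pred (sym p≡1+2n))
      (≋-trans (-U*v[2n]≋powerCoeff j) (≈⇒≋ (cong (powerCoeff n) (trans (index-from-top (toℕ j) j+d≡7 (ℕP.≤-trans d≤2 2≤n+n))
        (cong +_ (trans (cong (ℕ._∸ d) (cong ℕ.pred (sym p≡1+2n))) (ℕP.∸-+-assoc p 1 d)))))))
      where
      2≤n+n : 2 ≤ n ℕ.+ n
      2≤n+n = 2≤2n {n = n} (ℕ.nonTrivial⇒n>1 p {{prime⇒nonTrivial p-prime}}) p≡1+2n

odd⇒≡1+2[p∸1]/2 : ∀ p → ¬ (2 ∣ p) → p ≡ ℕ.suc ((p ℕ.∸ 1) / 2 ℕ.+ (p ℕ.∸ 1) / 2)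
odd⇒≡1+2[p∸1]/2 p 2∤p = trans p≡1+m*2 (cong ℕ.suc (trans (trans (ℕP.*-comm m 2) (cong (m ℕ.+_) (ℕP.+-identityʳ m)))
  (cong (λ k → k ℕ.+ k) (sym [p∸1]/2≡m))))
  where
  m = p / 2
  p%2≡1 : p % 2 ≡ 1
  p%2≡1 with p % 2 | m%n<n p 2 | m%n≡0⇒n∣m p 2
  ... | 0 | _                  | 2∣p = contradiction (2∣p refl) 2∤p
  ... | 1 | _                  | _   = refl
  ... | ℕ.suc (ℕ.suc _) | ℕ.s≤s (ℕ.s≤s ()) | _
  p≡1+m*2 : p ≡ 1 ℕ.+ m ℕ.* 2
  p≡1+m*2 = trans (m≡m%n+[m/n]*n p 2) (cong (ℕ._+ m ℕ.* 2) p%2≡1)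
  [p∸1]/2≡m : (p ℕ.∸ 1) / 2 ≡ m
  [p∸1]/2≡m = trans (cong (λ q → (q ℕ.∸ 1) / 2) p≡1+m*2) (m*n/n≡m m 2)

-- D being a non-square and h₀ ≢ 0 only matter for the paper's setting (K a field, h of
-- degree 8); the congruences hold without them.
proposition3p1 : (D : ℤ) → (∀ (n : ℤ) → n Data.Integer.* n ≢ D)
    → (h : Fin 9 → QF) → (∀ i → InOK D (h i)) → h zero ≢ 0K
    → (p : ℕ) → Prime p → ¬ (2 ∣ p)
    → (u : QF) → InOK D u → CongMod D p (mulK D (h zero) u) 1K
    → CongMod D p (Up D h p 1) (wVec D h p u (# 7))
      × CongMod D p (Up D h p 2) (wVec D h p u (# 6))
      × CongMod D p (Up D h p 3) (wVec D h p u (# 5))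
proposition3p1 D _ h h∈O _ p p-prime 2∤p u u∈O h₀u≡1 =
  coefficient 0 (# 7) refl z≤n , coefficient 1 (# 6) refl (s≤s z≤n) , coefficient 2 (# 5) refl ℕP.≤-refl
  where
  open ModuloP D p using (≋-sym; ≋⇒CongMod; CongMod⇒≋)
  open Invariant D h (integral ∘ h∈O) p ((p ℕ.∸ 1) / 2) (odd⇒≡1+2[p∸1]/2 p 2∤p) u (integral u∈O) (CongMod⇒≋ h₀u≡1)
  coefficient : ∀ d (j : Fin 8) → toℕ j ℕ.+ d ≡ 7 → d ≤ 2 → CongMod D p (Up D h p (suc d)) (wVec D h p u j)
  coefficient d j j+d≡7 d≤2 = ≋⇒CongMod (≋-sym (last-coefficients p-prime d j j+d≡7 d≤2))
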